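{- Let $M\in\mathbb{Z}^{r\times m}$ be circular with $m\ge r+2$. Then there exists $\Psi\in\mathbb{Z}^{m\times m}$ such that for every abelian group $G$, the homomorphism $\Psi:G^m\to G^m$ is an $(m,m,r+1)$-representation of $(M,G)$ (with $G_*=G$), with sets $C_j=\{j,\,j+1,\dots,j+r\}$ (indices mod $m$) for each $j\in[m]$.
   Context: For $j\in[m]$, $M_{(j)}$ is the $r\times r$ matrix formed by the columns of $M$ with indices $j-r,\dots,j-1$ mod $m$; $M$ is circular if every $M_{(j)}$ is unimodular. $\ker_G M=\{x\in G^m:Mx=0\}$. For $e\subset[t]$, $\gamma_e:G^e\to G^t$ inserts zeros outside $e$, $p_e$ is coordinate projection. For $\Psi:G_*^t\to G^m$, $\psi_j=p_j\circ\Psi$, $\mathrm{supp}\,\psi_j=\{i:\psi_j\circ\gamma_{\{i\}}\ne0\}$. A $(t,m,k)$-representation of $(M,G)$ is a homomorphism $\Psi:G_*^t\to G^m$, $G_*$ abelian, with: (i) distinct $k$-subsets $C_1,\dots,C_m$ of $[t]$ with $\mathrm{supp}\,\psi_j\subset C_j$; (ii) $\Psi(G_*^t)=\ker_G M$; (iii) $p_{C_j}(\ker_{G_*}\Psi)=\ker_{G_*}(\psi_j\circ\gamma_{C_j})$ for each $j$; when $G$ is second-countable compact, also $\Psi$ continuous and $G_*$ second-countable compact. -}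

module Defs where

open import Level using (Level; _⊔_; Setω)
open import Data.Nat as ℕ using (ℕ; zero; suc; _∸_; _≤_)
open import Data.Nat.DivMod using (_mod_)
open import Data.Integer as ℤ using (ℤ; +_; -[1+_])
open import Data.Fin using (Fin; zero; suc; toℕ; punchIn)
open import Data.Fin.Subset using (Subset; _∈_; ⁅_⁆; ∣_∣)
open import Data.Fin.Subset.Properties using (_∈?_)
open import Data.Fin.Properties using (any?) renaming (_≟_ to _≟F_)
open import Data.Vec using (tabulate)
open import Data.Bool using (Bool)
open import Data.Product using (Σ; _×_)
open import Data.Sum using (_⊎_)
open import Relation.Nullary using (¬_; yes; no; does)
open import Relation.Binary.PropositionalEquality using (_≡_; _≢_)
open import Algebra.Bundles using (AbelianGroup)

Mat : ℕ → ℕ → Set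
Mat p q = Fin p → Fin q → ℤ

∑ℤ : ∀ {n} → (Fin n → ℤ) → ℤ
∑ℤ {zero}  f = + 0
∑ℤ {suc n} f = f zero ℤ.+ ∑ℤ (λ i → f (suc i))

sgn : ℕ → ℤ
sgn zero          = + 1
sgn (suc zero)    = ℤ.- (+ 1)
sgn (suc (suc k)) = sgn k

det : ∀ n → Mat n n → ℤ
det zero    A = + 1
det (suc n) A = ∑ℤ (λ k → sgn (toℕ k) ℤ.* (A zero k ℤ.* det n (λ i l → A (suc i) (punchIn k l))))

Unimodular : ∀ {n} → Mat n n → Set
Unimodular {n} A = det n A ≡ + 1 ⊎ det n A ≡ -[1+ 0 ]

addMod : ∀ {m} → Fin m → ℕ → Fin m
addMod {suc n} j s = (toℕ j ℕ.+ s) mod (suc n)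

-- M_(j): the r×r matrix of columns j-r, …, j-1 (mod m)  (valid for r ≤ m)
subCols : ∀ {r m} → Mat r m → Fin m → Mat r r
subCols {r} {m} M j a b = M a (addMod j (m ∸ r ℕ.+ toℕ b))

Circular : ∀ {r m} → Mat r m → Set
Circular {r} {m} M = (j : Fin m) → Unimodular (subCols M j)

Cset : ∀ {m} (r : ℕ) → Fin m → Subset m
Cset r j = tabulate (λ i → does (any? (λ (s : Fin (suc r)) → i ≟F addMod j (toℕ s))))

record Σω (A : Set) (B : A → Setω) : Setω where
  constructor _,_
  field
    fst : A
    snd : B fst

module _ {c ℓ : Level} (G : AbelianGroup c ℓ) where
  open AbelianGroup G renaming (Carrier to A)

  infixr 8 _·_
  _·ℕ_ : ℕ → A → A
  zero  ·ℕ g = ε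
  suc n ·ℕ g = g ∙ (n ·ℕ g)

  _·_ : ℤ → A → A
  (+ n)    · g = n ·ℕ g
  -[1+ n ] · g = (suc n ·ℕ g) ⁻¹

  ∑ : ∀ {n} → (Fin n → A) → A
  ∑ {zero}  f = ε
  ∑ {suc n} f = f zero ∙ ∑ (λ i → f (suc i))

  act : ∀ {p q} → Mat p q → (Fin q → A) → (Fin p → A)
  act N x a = ∑ (λ i → N a i · x i)

  -- G^e for e ⊆ [t], represented as families indexed by the members of e
  Gpow : ∀ {t} → Subset t → Set c
  Gpow {t} e = (i : Fin t) → i ∈ e → A

  _≈ₑ_ : ∀ {t} {e : Subset t} → Gpow e → Gpow e → Set ℓ
  _≈ₑ_ {t} z w = (i : Fin t) (p : _) → z i p ≈ w i p

  γ : ∀ {t} (e : Subset t) → Gpow e → Fin t → A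
  γ e z i with i ∈? e
  ... | yes p = z i p
  ... | no  _ = ε

  proj : ∀ {t} (e : Subset t) → (Fin t → A) → Gpow e
  proj e x i _ = x i

  InSupp : ∀ {t} → ((Fin t → A) → A) → Fin t → Set (c ⊔ ℓ)
  InSupp ψ i = ¬ ((z : Gpow ⁅ i ⁆) → ψ (γ ⁅ i ⁆ z) ≈ ε)

  InKer : ∀ {p q} → Mat p q → (Fin q → A) → Set ℓ
  InKer N x = (a : _) → act N x a ≈ ε

  record IsRepresentation {r m t : ℕ} (k : ℕ) (M : Mat r m) (Ψ : Mat m t)
                          (C : Fin m → Subset t) : Set (c ⊔ ℓ) where
    ψ : Fin m → (Fin t → A) → A
    ψ j x = act Ψ x j
    field
      C-size     : (j : Fin m) → ∣ C j ∣ ≡ k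
      C-distinct : (j j′ : Fin m) → j ≢ j′ → C j ≢ C j′
      supp⊆C     : (j : Fin m) (i : Fin t) → InSupp (ψ j) i → i ∈ C j
      image⊆ker  : (y : Fin t → A) → InKer M (act Ψ y)
      ker⊆image  : (x : Fin m → A) → InKer M x →
                   Σ (Fin t → A) (λ y → (j : Fin m) → act Ψ y j ≈ x j)
      proj⊆ker   : (j : Fin m) (x : Fin t → A) → InKer Ψ x →
                   ψ j (γ (C j) (proj (C j) x)) ≈ ε
      ker⊆proj   : (j : Fin m) (z : Gpow (C j)) → ψ j (γ (C j) z) ≈ ε →
                   Σ (Fin t → A) (λ x → InKer Ψ x × _≈ₑ_ {e = C j} (proj (C j) x) z)

-- Column i of Ψ is the cofactor vector of the r × (r+1) block of columns
-- i - r, …, i of M, placed in rows i - r, …, i. Hence MΨ = 0, row j of Ψ is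
-- supported on C_j = {j, …, j + r}, and its last entry Ψ j (j + r) is ± det M₍ⱼ₊ᵣ₊₁₎,
-- a unit. An element of ker M vanishing on
-- m - r consecutive coordinates is zero, because the remaining r coordinates are
-- acted on by some unimodular M₍ⱼ₎. And since each row ends in a unit, the values
-- of Ψ y on consecutive rows can be prescribed by choosing the coordinates of y
-- one at a time. Surjectivity onto ker M and the description of p_{C_j}(ker Ψ)
-- both follow by controlling m - r consecutive rows of Ψ y and applying the first fact.

module Submission where

open import Defs hiding (_·_; _·ℕ_; ∑; act)
import Defs
open import Level using (Level)
open import Algebra.Bundles using (AbelianGroup; CommutativeMonoid)
open import Data.Bool using (Bool; true; false)
open import Data.Empty using (⊥; ⊥-elim)
open import Data.Fin as Fin using (Fin; zero; suc; toℕ; fromℕ<; punchIn; punchOut)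
import Data.Fin.Properties as Finₚ
open import Data.Fin.Subset using (Subset; _∈_; ∣_∣; ⁅_⁆)
open import Data.Fin.Subset.Properties using (_∈?_; x∈⁅y⁆⇒x≡y)
open import Data.Integer as ℤ using (ℤ; 0ℤ; 1ℤ; -1ℤ; -_; _*_)
import Data.Integer.Properties as ℤₚ
import Data.Integer.Tactic.RingSolver as ℤ-Solver
open import Data.Nat as ℕ using (ℕ; zero; suc; _∸_; _<_; _≤_; z≤n; s≤s)
open import Data.Nat.DivMod using (_%_; m%n<n; m%n≤m; %-distribˡ-+; m%n%n≡m%n; [m+n]%n≡m%n; m<n⇒m%n≡m)
import Data.Nat.Properties as ℕₚ
import Data.Nat.Tactic.RingSolver as ℕ-Solver
open import Data.Product using (Σ; _,_)
open import Data.Sum using (_⊎_; inj₁; inj₂)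
open import Data.Vec.Properties.WithK using ([]=-irrelevant)
open import Function using (_∘_)
import Relation.Binary.PropositionalEquality as ≡
open ≡ using (_≡_; _≢_)
open import Relation.Nullary using (¬_; Dec; yes; no; does; contradiction)
open import Relation.Nullary.Decidable using (dec-true)

module Determinant where

  open import Data.Integer using (_+_)
  open ≡
  open ≡-Reasoning
  open ℤ-Solver using (solve-∀)
  open import Data.Vec.Functional using (_∷_)
  open import Algebra.Properties.Semiring.Sum ℤₚ.+-*-semiring
    using (sum; sum-cong-≗; ∑-comm; sum-remove; *-distribˡ-sum; sum-replicate-zero)

  ∑ℤ≡sum : ∀ {n} (f : Fin n → ℤ) → ∑ℤ f ≡ sum f
  ∑ℤ≡sum {zero}  f = refl
  ∑ℤ≡sum {suc n} f = cong (f zero +_) (∑ℤ≡sum (λ i → f (suc i)))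

  ∑ℤ-cong : ∀ {n} {f g : Fin n → ℤ} → (∀ i → f i ≡ g i) → ∑ℤ f ≡ ∑ℤ g
  ∑ℤ-cong {f = f} {g} f≗g = begin
    ∑ℤ f   ≡⟨ ∑ℤ≡sum f ⟩
    sum f  ≡⟨ sum-cong-≗ f≗g ⟩
    sum g  ≡⟨ ∑ℤ≡sum g ⟨
    ∑ℤ g   ∎

  ∑ℤ-zero : ∀ n → ∑ℤ {n} (λ _ → 0ℤ) ≡ 0ℤ
  ∑ℤ-zero n = trans (∑ℤ≡sum {n} (λ _ → 0ℤ)) (sum-replicate-zero n)

  ∑ℤ-comm : ∀ {m n} (f : Fin m → Fin n → ℤ) →
            ∑ℤ (λ i → ∑ℤ (f i)) ≡ ∑ℤ (λ j → ∑ℤ (λ i → f i j))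
  ∑ℤ-comm f = begin
    ∑ℤ (λ i → ∑ℤ (f i))               ≡⟨ ∑ℤ-cong (λ i → ∑ℤ≡sum (f i)) ⟩
    ∑ℤ (λ i → sum (f i))              ≡⟨ ∑ℤ≡sum (λ i → sum (f i)) ⟩
    sum (λ i → sum (f i))             ≡⟨ ∑-comm f ⟩
    sum (λ j → sum (λ i → f i j))     ≡⟨ ∑ℤ≡sum (λ j → sum (λ i → f i j)) ⟨
    ∑ℤ (λ j → sum (λ i → f i j))      ≡⟨ ∑ℤ-cong (λ j → ∑ℤ≡sum (λ i → f i j)) ⟨
    ∑ℤ (λ j → ∑ℤ (λ i → f i j))       ∎

  *-distribˡ-∑ℤ : ∀ {n} c (f : Fin n → ℤ) → c * ∑ℤ f ≡ ∑ℤ (λ i → c * f i)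
  *-distribˡ-∑ℤ c f = begin
    c * ∑ℤ f              ≡⟨ cong (c *_) (∑ℤ≡sum f) ⟩
    c * sum f             ≡⟨ *-distribˡ-sum c f ⟩
    sum (λ i → c * f i)   ≡⟨ ∑ℤ≡sum (λ i → c * f i) ⟨
    ∑ℤ (λ i → c * f i)    ∎

  neg-distrib-∑ℤ : ∀ {n} (f : Fin n → ℤ) → - ∑ℤ f ≡ ∑ℤ (λ i → - f i)
  neg-distrib-∑ℤ f = begin
    - ∑ℤ f                ≡⟨ ℤₚ.-1*i≡-i (∑ℤ f) ⟨
    -1ℤ * ∑ℤ f            ≡⟨ *-distribˡ-∑ℤ -1ℤ f ⟩
    ∑ℤ (λ i → -1ℤ * f i)  ≡⟨ ∑ℤ-cong (λ i → ℤₚ.-1*i≡-i (f i)) ⟩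
    ∑ℤ (λ i → - f i)      ∎

  ∑ℤ-remove : ∀ {n} (f : Fin (suc n) → ℤ) k → ∑ℤ f ≡ f k + ∑ℤ (λ l → f (punchIn k l))
  ∑ℤ-remove f k = begin
    ∑ℤ f                               ≡⟨ ∑ℤ≡sum f ⟩
    sum f                              ≡⟨ sum-remove f ⟩
    f k + sum (λ l → f (punchIn k l))  ≡⟨ cong (f k +_) (∑ℤ≡sum (λ l → f (punchIn k l))) ⟨
    f k + ∑ℤ (λ l → f (punchIn k l))   ∎

  x≡-x⇒x≡0 : ∀ x → x ≡ - x → x ≡ 0ℤ
  x≡-x⇒x≡0 ℤ.+0         _  = refl
  x≡-x⇒x≡0 ℤ.+[1+ n ]    ()
  x≡-x⇒x≡0 ℤ.-[1+ n ]    ()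

  -- (k , l) ↦ (punchIn k l , pairSwap k l) exchanges the two entries of the
  -- ordered pair of distinct indices (k , punchIn k l).
  pairSwap : ∀ {n} → Fin (suc (suc n)) → Fin (suc n) → Fin (suc n)
  pairSwap zero    l       = zero
  pairSwap (suc k) zero    = k
  pairSwap {suc n} (suc k) (suc l) = suc (pairSwap k l)

  punchIn-pairSwap : ∀ {n} (k : Fin (suc (suc n))) l → punchIn (punchIn k l) (pairSwap k l) ≡ k
  punchIn-pairSwap zero    l       = refl
  punchIn-pairSwap (suc k) zero    = refl
  punchIn-pairSwap {suc n} (suc k) (suc l) = cong suc (punchIn-pairSwap k l)

  punchIn-punchIn-pairSwap : ∀ {n} (k : Fin (suc (suc n))) l (b : Fin n) →
    punchIn k (punchIn l b) ≡ punchIn (punchIn k l) (punchIn (pairSwap k l) b)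
  punchIn-punchIn-pairSwap zero    l       b       = refl
  punchIn-punchIn-pairSwap (suc k) zero    b       = refl
  punchIn-punchIn-pairSwap {suc n} (suc k) (suc l) zero    = refl
  punchIn-punchIn-pairSwap {suc n} (suc k) (suc l) (suc b) = cong suc (punchIn-punchIn-pairSwap k l b)

  sgn-suc : ∀ n → sgn (suc n) ≡ - sgn n
  sgn-suc zero          = refl
  sgn-suc (suc zero)    = refl
  sgn-suc (suc (suc n)) = sgn-suc n

  sgn-pairSwap : ∀ {n} (k : Fin (suc (suc n))) l →
    sgn (toℕ k) * sgn (toℕ l) ≡ - (sgn (toℕ (punchIn k l)) * sgn (toℕ (pairSwap k l)))
  sgn-pairSwap zero l = begin
    1ℤ * sgn (toℕ l)            ≡⟨ ℤₚ.*-identityˡ _ ⟩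
    sgn (toℕ l)                 ≡⟨ ℤₚ.neg-involutive _ ⟨
    - - sgn (toℕ l)             ≡⟨ cong -_ (sgn-suc (toℕ l)) ⟨
    - sgn (suc (toℕ l))         ≡⟨ cong -_ (ℤₚ.*-identityʳ _) ⟨
    - (sgn (suc (toℕ l)) * 1ℤ)  ∎
  sgn-pairSwap (suc k) zero = begin
    sgn (suc (toℕ k)) * 1ℤ  ≡⟨ ℤₚ.*-identityʳ _ ⟩
    sgn (suc (toℕ k))       ≡⟨ sgn-suc (toℕ k) ⟩
    - sgn (toℕ k)           ≡⟨ cong -_ (ℤₚ.*-identityˡ _) ⟨
    - (1ℤ * sgn (toℕ k))    ∎
  sgn-pairSwap {suc n} (suc k) (suc l) = begin
    sgn (suc (toℕ k)) * sgn (suc (toℕ l))  ≡⟨ cong₂ _*_ (sgn-suc (toℕ k)) (sgn-suc (toℕ l)) ⟩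
    - sgn (toℕ k) * - sgn (toℕ l)          ≡⟨ neg*neg (sgn (toℕ k)) (sgn (toℕ l)) ⟩
    sgn (toℕ k) * sgn (toℕ l)              ≡⟨ sgn-pairSwap k l ⟩
    - (sgn (toℕ k′) * sgn (toℕ l′))        ≡⟨ cong -_ (neg*neg (sgn (toℕ k′)) (sgn (toℕ l′))) ⟨
    - (- sgn (toℕ k′) * - sgn (toℕ l′))    ≡⟨ cong -_ (cong₂ _*_ (sgn-suc (toℕ k′)) (sgn-suc (toℕ l′))) ⟨
    - (sgn (suc (toℕ k′)) * sgn (suc (toℕ l′))) ∎
    where
    k′ = punchIn k l
    l′ = pairSwap k l
    neg*neg : ∀ a b → - a * - b ≡ a * b
    neg*neg = solve-∀

  *-*-distrib-∑ℤ : ∀ {n} s x (g : Fin n → ℤ) → s * (x * ∑ℤ g) ≡ ∑ℤ (λ k → s * (x * g k))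
  *-*-distrib-∑ℤ s x g = trans (cong (s *_) (*-distribˡ-∑ℤ x g)) (*-distribˡ-∑ℤ s (λ k → x * g k))

  det-cong : ∀ n {A B : Mat n n} → (∀ i j → A i j ≡ B i j) → det n A ≡ det n B
  det-cong zero    A≡B = refl
  det-cong (suc n) A≡B = ∑ℤ-cong λ k →
    cong₂ (λ x y → sgn (toℕ k) * (x * y)) (A≡B zero k) (det-cong n (λ i l → A≡B (suc i) (punchIn k l)))

  _ᵀ : ∀ {p q} → Mat p q → Mat q p
  (A ᵀ) i j = A j i

  -- Expanding A along row 0 and then each minor along column 0, and Aᵀ the
  -- other way round, produces the same double sum ∑ c k term c k.
  det-transpose : ∀ n (A : Mat n n) → det n (A ᵀ) ≡ det n A
  det-transpose zero          A = refl
  det-transpose (suc zero)    A = refl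
  det-transpose (suc (suc p)) A = cong₂ _+_
    (cong (λ x → sgn 0 * (A zero zero * x)) (det-transpose (suc p) (λ i l → A (suc i) (suc l))))
    (begin
      ∑ℤ (λ c → sgn (toℕ (suc c)) * (A (suc c) zero * det (suc p) ((rowMinor c) ᵀ)))
    ≡⟨ ∑ℤ-cong (λ c → cong (λ x → sgn (suc (toℕ c)) * (A (suc c) zero * x)) (det-transpose (suc p) (rowMinor c))) ⟩
      ∑ℤ (λ c → sgn (suc (toℕ c)) * (A (suc c) zero * ∑ℤ (λ k → sgn (toℕ k) * (A zero (suc k) * det p (minor c k)))))
    ≡⟨ ∑ℤ-cong expandRow ⟩
      ∑ℤ (λ c → ∑ℤ (term c))
    ≡⟨ ∑ℤ-comm term ⟩
      ∑ℤ (λ k → ∑ℤ (λ c → term c k))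
    ≡⟨ ∑ℤ-cong expandColumn ⟨
      ∑ℤ (λ k → sgn (suc (toℕ k)) * (A zero (suc k) * ∑ℤ (λ c → sgn (toℕ c) * (A (suc c) zero * det p ((minor c k) ᵀ)))))
    ≡⟨ ∑ℤ-cong (λ k → cong (λ x → sgn (suc (toℕ k)) * (A zero (suc k) * x)) (det-transpose (suc p) (columnMinor k))) ⟩
      ∑ℤ (λ k → sgn (toℕ (suc k)) * (A zero (suc k) * det (suc p) (columnMinor k)))
    ∎)
    where
    rowMinor columnMinor : Fin (suc p) → Mat (suc p) (suc p)
    rowMinor c i l = A (punchIn (suc c) i) (suc l)
    columnMinor k i l = A (suc i) (punchIn (suc k) l)
    minor : Fin (suc p) → Fin (suc p) → Mat p p
    minor c k a b = A (suc (punchIn c a)) (suc (punchIn k b))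
    term : Fin (suc p) → Fin (suc p) → ℤ
    term c k = - (sgn (toℕ c) * sgn (toℕ k) * A (suc c) zero * A zero (suc k) * det p (minor c k))
    expandRow : ∀ c → sgn (suc (toℕ c)) * (A (suc c) zero * ∑ℤ (λ k → sgn (toℕ k) * (A zero (suc k) * det p (minor c k))))
                    ≡ ∑ℤ (term c)
    expandRow c = trans
      (*-*-distrib-∑ℤ (sgn (suc (toℕ c))) (A (suc c) zero) (λ k → sgn (toℕ k) * (A zero (suc k) * det p (minor c k))))
      (∑ℤ-cong λ k →
        trans (cong (λ s → s * (A (suc c) zero * (sgn (toℕ k) * (A zero (suc k) * det p (minor c k))))) (sgn-suc (toℕ c)))
              (ring (sgn (toℕ c)) (sgn (toℕ k)) (A (suc c) zero) (A zero (suc k)) (det p (minor c k))))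
      where ring : ∀ s t x y z → - s * (x * (t * (y * z))) ≡ - (s * t * x * y * z)
            ring = solve-∀
    expandColumn : ∀ k → sgn (suc (toℕ k)) * (A zero (suc k) * ∑ℤ (λ c → sgn (toℕ c) * (A (suc c) zero * det p ((minor c k) ᵀ))))
                       ≡ ∑ℤ (λ c → term c k)
    expandColumn k = trans
      (*-*-distrib-∑ℤ (sgn (suc (toℕ k))) (A zero (suc k)) (λ c → sgn (toℕ c) * (A (suc c) zero * det p ((minor c k) ᵀ))))
      (∑ℤ-cong λ c →
        trans (cong₂ (λ s x → s * (A zero (suc k) * (sgn (toℕ c) * (A (suc c) zero * x)))) (sgn-suc (toℕ k)) (det-transpose p (minor c k)))
              (ring (sgn (toℕ c)) (sgn (toℕ k)) (A (suc c) zero) (A zero (suc k)) (det p (minor c k))))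
      where ring : ∀ s t x y z → - t * (y * (s * (x * z))) ≡ - (s * t * x * y * z)
            ring = solve-∀

  module _ {n : ℕ} where

    offDiagonal : (Fin (suc n) → Fin n → ℤ) → Fin (suc n) → Fin (suc n) → ℤ
    offDiagonal F k c with k Fin.≟ c
    ... | yes _   = 0ℤ
    ... | no k≢c = F k (punchOut k≢c)

    offDiagonal-diagonal : ∀ F k → offDiagonal F k k ≡ 0ℤ
    offDiagonal-diagonal F k with k Fin.≟ k
    ... | yes _   = refl
    ... | no k≢k = contradiction refl k≢k

    offDiagonal-punchIn : ∀ F k l → offDiagonal F k (punchIn k l) ≡ F k l
    offDiagonal-punchIn F k l with k Fin.≟ punchIn k l
    ... | yes k≡c = contradiction (sym k≡c) (Finₚ.punchInᵢ≢i k l)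
    ... | no k≢c = cong (F k) (Finₚ.punchIn-injective k _ _ (Finₚ.punchIn-punchOut k≢c))

    ∑ℤ-offDiagonal : ∀ F k → ∑ℤ (offDiagonal F k) ≡ ∑ℤ (F k)
    ∑ℤ-offDiagonal F k = begin
      ∑ℤ (offDiagonal F k)                                         ≡⟨ ∑ℤ-remove (offDiagonal F k) k ⟩
      offDiagonal F k k + ∑ℤ (λ l → offDiagonal F k (punchIn k l))
        ≡⟨ cong₂ _+_ (offDiagonal-diagonal F k) (∑ℤ-cong (offDiagonal-punchIn F k)) ⟩
      0ℤ + ∑ℤ (F k)                                                ≡⟨ ℤₚ.+-identityˡ _ ⟩
      ∑ℤ (F k)                                                     ∎

  ∑∑-pairSwap : ∀ {n} (F G : Fin (suc (suc n)) → Fin (suc n) → ℤ) →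
    (∀ k l → G k l ≡ - F (punchIn k l) (pairSwap k l)) →
    ∑ℤ (λ k → ∑ℤ (G k)) ≡ - ∑ℤ (λ k → ∑ℤ (F k))
  ∑∑-pairSwap F G G≡-F = begin
    ∑ℤ (λ k → ∑ℤ (G k))                                ≡⟨ ∑ℤ-cong (λ k → ∑ℤ-offDiagonal G k) ⟨
    ∑ℤ (λ k → ∑ℤ (offDiagonal G k))                    ≡⟨ ∑ℤ-cong (λ k → ∑ℤ-cong (antisymmetric k)) ⟩
    ∑ℤ (λ k → ∑ℤ (λ c → - offDiagonal F c k))          ≡⟨ ∑ℤ-comm (λ k c → - offDiagonal F c k) ⟩
    ∑ℤ (λ c → ∑ℤ (λ k → - offDiagonal F c k))          ≡⟨ ∑ℤ-cong (λ c → neg-distrib-∑ℤ (offDiagonal F c)) ⟨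
    ∑ℤ (λ c → - ∑ℤ (offDiagonal F c))                  ≡⟨ ∑ℤ-cong (λ c → cong -_ (∑ℤ-offDiagonal F c)) ⟩
    ∑ℤ (λ c → - ∑ℤ (F c))                              ≡⟨ neg-distrib-∑ℤ (λ c → ∑ℤ (F c)) ⟨
    - ∑ℤ (λ c → ∑ℤ (F c))                              ∎
    where
    antisymmetric-punchIn : ∀ k l → offDiagonal G k (punchIn k l) ≡ - offDiagonal F (punchIn k l) k
    antisymmetric-punchIn k l = begin
      offDiagonal G k (punchIn k l)                 ≡⟨ offDiagonal-punchIn G k l ⟩
      G k l                                         ≡⟨ G≡-F k l ⟩
      - F c (pairSwap k l)                          ≡⟨ cong -_ (offDiagonal-punchIn F c (pairSwap k l)) ⟨
      - offDiagonal F c (punchIn c (pairSwap k l))  ≡⟨ cong (λ i → - offDiagonal F c i) (punchIn-pairSwap k l) ⟩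
      - offDiagonal F c k                           ∎
      where c = punchIn k l
    antisymmetric : ∀ k c → offDiagonal G k c ≡ - offDiagonal F c k
    antisymmetric k c = byCases (k Fin.≟ c)
      where
      byCases : Dec (k ≡ c) → offDiagonal G k c ≡ - offDiagonal F c k
      byCases (yes refl) = trans (offDiagonal-diagonal G k) (cong -_ (sym (offDiagonal-diagonal F k)))
      byCases (no k≢c)  = subst (λ c → offDiagonal G k c ≡ - offDiagonal F c k)
                                (Finₚ.punchIn-punchOut k≢c) (antisymmetric-punchIn k (punchOut k≢c))

  swap01 : ∀ {n} → Fin (suc (suc n)) → Fin (suc (suc n))
  swap01 zero          = suc zero
  swap01 (suc zero)    = zero
  swap01 (suc (suc a)) = suc (suc a)

  module _ (n : ℕ) (A : Mat (suc (suc n)) (suc (suc n))) where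

    minor₂ : Fin (suc (suc n)) → Fin (suc n) → ℤ
    minor₂ k l = det n (λ a b → A (suc (suc a)) (punchIn k (punchIn l b)))

    -- Laplace expansion along rows 0 and 1: column k in row 0, column punchIn k l in row 1
    expansion₂ : Fin (suc (suc n)) → Fin (suc n) → ℤ
    expansion₂ k l = sgn (toℕ k) * (A zero k * (sgn (toℕ l) * (A (suc zero) (punchIn k l) * minor₂ k l)))

    det-expansion₂ : det (suc (suc n)) A ≡ ∑ℤ (λ k → ∑ℤ (expansion₂ k))
    det-expansion₂ = ∑ℤ-cong λ k →
      *-*-distrib-∑ℤ (sgn (toℕ k)) (A zero k) (λ l → sgn (toℕ l) * (A (suc zero) (punchIn k l) * minor₂ k l))

  det-swap01 : ∀ n (A : Mat (suc (suc n)) (suc (suc n))) → det (suc (suc n)) (λ a → A (swap01 a)) ≡ - det (suc (suc n)) A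
  det-swap01 n A = begin
    det (suc (suc n)) (λ a → A (swap01 a))                   ≡⟨ det-expansion₂ n (λ a → A (swap01 a)) ⟩
    ∑ℤ (λ k → ∑ℤ (expansion₂ n (λ a → A (swap01 a)) k))
      ≡⟨ ∑∑-pairSwap (expansion₂ n A) (expansion₂ n (λ a → A (swap01 a))) swapped ⟩
    - ∑ℤ (λ k → ∑ℤ (expansion₂ n A k))                       ≡⟨ cong -_ (det-expansion₂ n A) ⟨
    - det (suc (suc n)) A                                    ∎
    where
    swapped : ∀ k l → expansion₂ n (λ a → A (swap01 a)) k l ≡ - expansion₂ n A (punchIn k l) (pairSwap k l)
    swapped k l = begin
        sgn (toℕ k) * (A (suc zero) k * (sgn (toℕ l) * (A zero c * minor₂ n A k l)))
      ≡⟨ ring (sgn (toℕ k)) (sgn (toℕ l)) (sgn (toℕ c)) (sgn (toℕ l′)) (A (suc zero) k) (A zero c) (minor₂ n A k l)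
              (sgn-pairSwap k l) ⟩
        - (sgn (toℕ c) * (A zero c * (sgn (toℕ l′) * (A (suc zero) k * minor₂ n A k l))))
      ≡⟨ cong₂ (λ i x → - (sgn (toℕ c) * (A zero c * (sgn (toℕ l′) * (A (suc zero) i * x)))))
               (sym (punchIn-pairSwap k l)) (det-cong n (λ a b → cong (A (suc (suc a))) (punchIn-punchIn-pairSwap k l b))) ⟩
        - (sgn (toℕ c) * (A zero c * (sgn (toℕ l′) * (A (suc zero) (punchIn c l′) * minor₂ n A c l′))))
      ∎
      where
      c  = punchIn k l
      l′ = pairSwap k l
      ring : ∀ s t s′ t′ x y z → s * t ≡ - (s′ * t′) → s * (x * (t * (y * z))) ≡ - (s′ * (y * (t′ * (x * z))))
      ring s t s′ t′ x y z st≡-s′t′ = begin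
        s * (x * (t * (y * z)))      ≡⟨ regroup s t x y z ⟩
        (s * t) * (x * y * z)        ≡⟨ cong (_* (x * y * z)) st≡-s′t′ ⟩
        - (s′ * t′) * (x * y * z)    ≡⟨ regroup′ s′ t′ x y z ⟩
        - (s′ * (y * (t′ * (x * z)))) ∎
        where
        regroup : ∀ s t x y z → s * (x * (t * (y * z))) ≡ (s * t) * (x * y * z)
        regroup = solve-∀
        regroup′ : ∀ s t x y z → - (s * t) * (x * y * z) ≡ - (s * (y * (t * (x * z))))
        regroup′ = solve-∀

  det-rows01-equal : ∀ n (A : Mat (suc (suc n)) (suc (suc n))) →
    (∀ l → A zero l ≡ A (suc zero) l) → det (suc (suc n)) A ≡ 0ℤ
  det-rows01-equal n A row0≡row1 = x≡-x⇒x≡0 _ (begin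
    det (suc (suc n)) A                        ≡⟨ det-cong (suc (suc n)) swap01-fixes ⟨
    det (suc (suc n)) (λ a → A (swap01 a))     ≡⟨ det-swap01 n A ⟩
    - det (suc (suc n)) A                      ∎)
    where
    swap01-fixes : ∀ a l → A (swap01 a) l ≡ A a l
    swap01-fixes zero          l = sym (row0≡row1 l)
    swap01-fixes (suc zero)    l = row0≡row1 l
    swap01-fixes (suc (suc a)) l = refl

  -- Rows 0 and 1 are swapped first, so that the repeated row survives in
  -- every minor of the expansion along row 0.
  det-repeated-row0 : ∀ n (A : Mat (suc n) (suc n)) (i : Fin n) →
    (∀ l → A zero l ≡ A (suc i) l) → det (suc n) A ≡ 0ℤ
  det-repeated-row0 (suc n) A zero    row0≡row = det-rows01-equal n A row0≡row
  det-repeated-row0 (suc n) A (suc i) row0≡row = begin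
    det (suc (suc n)) A                         ≡⟨ ℤₚ.neg-involutive _ ⟨
    - - det (suc (suc n)) A                     ≡⟨ cong -_ (det-swap01 n A) ⟨
    - det (suc (suc n)) (λ a → A (swap01 a))    ≡⟨ cong -_ (∑ℤ-cong vanishingTerm) ⟩
    - ∑ℤ {suc (suc n)} (λ _ → 0ℤ)                ≡⟨ cong -_ (∑ℤ-zero (suc (suc n))) ⟩
    0ℤ                                          ∎
    where
    vanishingTerm : ∀ k → sgn (toℕ k) * (A (suc zero) k * det (suc n) (λ a l → A (swap01 (suc a)) (punchIn k l))) ≡ 0ℤ
    vanishingTerm k = begin
      sgn (toℕ k) * (A (suc zero) k * det (suc n) (λ a l → A (swap01 (suc a)) (punchIn k l)))
        ≡⟨ cong (λ x → sgn (toℕ k) * (A (suc zero) k * x))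
                (det-repeated-row0 n (λ a l → A (swap01 (suc a)) (punchIn k l)) i (λ l → row0≡row (punchIn k l))) ⟩
      sgn (toℕ k) * (A (suc zero) k * 0ℤ)
        ≡⟨ cong (sgn (toℕ k) *_) (ℤₚ.*-zeroʳ (A (suc zero) k)) ⟩
      sgn (toℕ k) * 0ℤ
        ≡⟨ ℤₚ.*-zeroʳ (sgn (toℕ k)) ⟩
      0ℤ ∎

  cofactor : ∀ {r} → Mat r (suc r) → Fin (suc r) → ℤ
  cofactor {r} N k = sgn (toℕ k) * det r (λ i l → N i (punchIn k l))

  -- ∑ₖ N a k · cofactor N k is the determinant of N with its row a repeated on top.
  cofactor-orthogonal : ∀ {r} (N : Mat r (suc r)) a → ∑ℤ (λ k → N a k * cofactor N k) ≡ 0ℤ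
  cofactor-orthogonal {r} N a = begin
    ∑ℤ (λ k → N a k * cofactor N k)  ≡⟨ ∑ℤ-cong (λ k → swap (N a k) (sgn (toℕ k)) (det r (λ i l → N i (punchIn k l)))) ⟩
    det (suc r) (N a ∷ N)            ≡⟨ det-repeated-row0 r (N a ∷ N) a (λ l → refl) ⟩
    0ℤ                               ∎
    where
    swap : ∀ x s d → x * (s * d) ≡ s * (x * d)
    swap = solve-∀

  δ : ∀ {n} → Fin n → Fin n → ℤ
  δ i j with i Fin.≟ j
  ... | yes _ = 1ℤ
  ... | no _  = 0ℤ

  IsUnit : ℤ → Set
  IsUnit x = x * x ≡ 1ℤ

  sgn-unit : ∀ k → IsUnit (sgn k)
  sgn-unit zero          = refl
  sgn-unit (suc zero)    = refl
  sgn-unit (suc (suc k)) = sgn-unit k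

  unit-* : ∀ x y → IsUnit x → IsUnit y → IsUnit (x * y)
  unit-* x y x²≡1 y²≡1 = trans (square-* x y) (cong₂ _*_ x²≡1 y²≡1)
    where
    square-* : ∀ x y → (x * y) * (x * y) ≡ (x * x) * (y * y)
    square-* = solve-∀

  unimodular⇒unit-det : ∀ {n} (A : Mat n n) → Unimodular A → IsUnit (det n A)
  unimodular⇒unit-det A (inj₁ det≡1)  rewrite det≡1  = refl
  unimodular⇒unit-det A (inj₂ det≡-1) rewrite det≡-1 = refl

  -- Row b of the inverse is read off the cofactors of the matrix whose first
  -- column is the b-th unit vector and whose remaining columns are those of Aᵀ.
  unimodular-leftInverse : ∀ r (A : Mat r r) → Unimodular A →
    Σ (Mat r r) λ L → ∀ b a → ∑ℤ (λ l → L b l * A l a) ≡ δ b a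
  unimodular-leftInverse r A unimodular = L , L-inverse
    where
    d = det r A
    augmented : Fin r → Mat r (suc r)
    augmented b i = δ b i ∷ λ l → A l i
    cofactor₀ : ∀ b → cofactor (augmented b) zero ≡ d
    cofactor₀ b = trans (ℤₚ.*-identityˡ _) (det-transpose r A)
    L : Mat r r
    L b l = - d * cofactor (augmented b) (suc l)
    L-inverse : ∀ b a → ∑ℤ (λ l → L b l * A l a) ≡ δ b a
    L-inverse b a = begin
        ∑ℤ (λ l → L b l * A l a)
      ≡⟨ ∑ℤ-cong (λ l → reassoc d (cofactor (augmented b) (suc l)) (A l a)) ⟩
        ∑ℤ (λ l → - d * (A l a * cofactor (augmented b) (suc l)))
      ≡⟨ *-distribˡ-∑ℤ (- d) (λ l → A l a * cofactor (augmented b) (suc l)) ⟨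
        - d * ∑ℤ (λ l → A l a * cofactor (augmented b) (suc l))
      ≡⟨ cong (- d *_) (x+y≡0⇒y≡-x (cofactor-orthogonal (augmented b) a)) ⟩
        - d * - (δ b a * cofactor (augmented b) zero)
      ≡⟨ cong (λ x → - d * - (δ b a * x)) (cofactor₀ b) ⟩
        - d * - (δ b a * d)
      ≡⟨ square d (δ b a) ⟩
        (d * d) * δ b a
      ≡⟨ cong (_* δ b a) (unimodular⇒unit-det A unimodular) ⟩
        1ℤ * δ b a
      ≡⟨ ℤₚ.*-identityˡ (δ b a) ⟩
        δ b a
      ∎
      where
      reassoc : ∀ d w x → (- d * w) * x ≡ - d * (x * w)
      reassoc = solve-∀
      square : ∀ d e → - d * - (e * d) ≡ (d * d) * e
      square = solve-∀
      x+y≡0⇒y≡-x : ∀ {x y} → x + y ≡ 0ℤ → y ≡ - x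
      x+y≡0⇒y≡-x {x} {y} x+y≡0 = trans (sym (cancel x y)) (trans (cong (_+ - x) x+y≡0) (ℤₚ.+-identityˡ (- x)))
        where cancel : ∀ x y → x + y + - x ≡ y
              cancel = solve-∀

open Determinant

module ZModule {c ℓ : Level} (G : AbelianGroup c ℓ) where

  open AbelianGroup G renaming (Carrier to A)
  open import Relation.Binary.Reasoning.Setoid setoid
  open import Algebra.Properties.AbelianGroup G using (⁻¹-∙-comm)
  open import Algebra.Properties.Group group using (⁻¹-involutive; ε⁻¹≈ε; inverseʳ-unique)
  open import Algebra.Properties.Monoid.Mult monoid using (_×_; ×-homo-+)
  open import Algebra.Properties.CommutativeMonoid.Mult commutativeMonoid using (×-distrib-+)
  open import Algebra.Properties.CommutativeMonoid.Sum commutativeMonoid using (sum; ∑-distrib-+; ∑-comm)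

  infixr 8 _·ℕ_ _·_
  _·ℕ_ : ℕ → A → A
  _·ℕ_ = Defs._·ℕ_ G
  _·_ : ℤ → A → A
  _·_ = Defs._·_ G
  ∑ : ∀ {n} → (Fin n → A) → A
  ∑ = Defs.∑ G
  act : ∀ {p q} → Mat p q → (Fin q → A) → (Fin p → A)
  act = Defs.act G

  ·ℕ≡× : ∀ n g → n ·ℕ g ≡ n × g
  ·ℕ≡× zero    g = ≡.refl
  ·ℕ≡× (suc n) g = ≡.cong (g ∙_) (·ℕ≡× n g)

  ·ℕ-distribʳ-+ : ∀ m n g → (m ℕ.+ n) ·ℕ g ≈ m ·ℕ g ∙ n ·ℕ g
  ·ℕ-distribʳ-+ m n g = begin
    (m ℕ.+ n) ·ℕ g    ≡⟨ ·ℕ≡× (m ℕ.+ n) g ⟩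
    (m ℕ.+ n) × g     ≈⟨ ×-homo-+ g m n ⟩
    m × g ∙ n × g     ≡⟨ ≡.cong₂ _∙_ (·ℕ≡× m g) (·ℕ≡× n g) ⟨
    m ·ℕ g ∙ n ·ℕ g   ∎

  ·ℕ-distribˡ-∙ : ∀ n g h → n ·ℕ (g ∙ h) ≈ n ·ℕ g ∙ n ·ℕ h
  ·ℕ-distribˡ-∙ n g h = begin
    n ·ℕ (g ∙ h)      ≡⟨ ·ℕ≡× n (g ∙ h) ⟩
    n × (g ∙ h)       ≈⟨ ×-distrib-+ g h n ⟩
    n × g ∙ n × h     ≡⟨ ≡.cong₂ _∙_ (·ℕ≡× n g) (·ℕ≡× n h) ⟨
    n ·ℕ g ∙ n ·ℕ h   ∎

  ·ℕ-congˡ : ∀ n {g h} → g ≈ h → n ·ℕ g ≈ n ·ℕ h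
  ·ℕ-congˡ zero    g≈h = refl
  ·ℕ-congˡ (suc n) g≈h = ∙-cong g≈h (·ℕ-congˡ n g≈h)

  ·ℕ-zeroʳ : ∀ n → n ·ℕ ε ≈ ε
  ·ℕ-zeroʳ zero    = refl
  ·ℕ-zeroʳ (suc n) = trans (identityˡ _) (·ℕ-zeroʳ n)

  ·-congˡ : ∀ a {g h} → g ≈ h → a · g ≈ a · h
  ·-congˡ (ℤ.+ n)    g≈h = ·ℕ-congˡ n g≈h
  ·-congˡ ℤ.-[1+ n ] g≈h = ⁻¹-cong (·ℕ-congˡ (suc n) g≈h)

  ·-zeroʳ : ∀ a → a · ε ≈ ε
  ·-zeroʳ (ℤ.+ n)    = ·ℕ-zeroʳ n
  ·-zeroʳ ℤ.-[1+ n ] = trans (⁻¹-cong (·ℕ-zeroʳ (suc n))) ε⁻¹≈ε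

  ·-identityˡ : ∀ g → 1ℤ · g ≈ g
  ·-identityˡ = identityʳ

  ·-distribˡ-∙ : ∀ a g h → a · (g ∙ h) ≈ a · g ∙ a · h
  ·-distribˡ-∙ (ℤ.+ n)    g h = ·ℕ-distribˡ-∙ n g h
  ·-distribˡ-∙ ℤ.-[1+ n ] g h = trans (⁻¹-cong (·ℕ-distribˡ-∙ (suc n) g h)) (sym (⁻¹-∙-comm _ _))

  neg-· : ∀ a g → (- a) · g ≈ (a · g) ⁻¹
  neg-· ℤ.+0         g = sym ε⁻¹≈ε
  neg-· ℤ.+[1+ n ]   g = refl
  neg-· ℤ.-[1+ n ]   g = sym (⁻¹-involutive _)

  ⊖-· : ∀ m n g → (m ℤ.⊖ n) · g ≈ m ·ℕ g ∙ (n ·ℕ g) ⁻¹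
  ⊖-· zero    zero    g = sym (trans (identityˡ _) ε⁻¹≈ε)
  ⊖-· zero    (suc n) g = sym (identityˡ _)
  ⊖-· (suc m) zero    g = sym (trans (∙-congˡ ε⁻¹≈ε) (identityʳ _))
  ⊖-· (suc m) (suc n) g = begin
    (suc m ℤ.⊖ suc n) · g              ≡⟨ ≡.cong (_· g) (ℤₚ.[1+m]⊖[1+n]≡m⊖n m n) ⟩
    (m ℤ.⊖ n) · g                      ≈⟨ ⊖-· m n g ⟩
    m ·ℕ g ∙ (n ·ℕ g) ⁻¹               ≈⟨ ∙-congˡ (trans (∙-congʳ (inverseʳ g)) (identityˡ _)) ⟨
    m ·ℕ g ∙ (g ∙ g ⁻¹ ∙ (n ·ℕ g) ⁻¹)  ≈⟨ sym (assoc _ _ _) ⟩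
    m ·ℕ g ∙ (g ∙ g ⁻¹) ∙ (n ·ℕ g) ⁻¹  ≈⟨ ∙-congʳ (sym (assoc _ _ _)) ⟩
    m ·ℕ g ∙ g ∙ g ⁻¹ ∙ (n ·ℕ g) ⁻¹    ≈⟨ assoc _ _ _ ⟩
    m ·ℕ g ∙ g ∙ (g ⁻¹ ∙ (n ·ℕ g) ⁻¹)  ≈⟨ ∙-cong (comm _ _) (⁻¹-∙-comm _ _) ⟩
    suc m ·ℕ g ∙ (suc n ·ℕ g) ⁻¹       ∎

  ·-distribʳ-+ : ∀ a b g → (a ℤ.+ b) · g ≈ a · g ∙ b · g
  ·-distribʳ-+ (ℤ.+ m)    (ℤ.+ n)    g = ·ℕ-distribʳ-+ m n g
  ·-distribʳ-+ (ℤ.+ m)    ℤ.-[1+ n ] g = ⊖-· m (suc n) g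
  ·-distribʳ-+ ℤ.-[1+ m ] (ℤ.+ n)    g = trans (⊖-· n (suc m) g) (comm _ _)
  ·-distribʳ-+ ℤ.-[1+ m ] ℤ.-[1+ n ] g = begin
    (suc (suc (m ℕ.+ n)) ·ℕ g) ⁻¹    ≡⟨ ≡.cong (λ k → (suc k ·ℕ g) ⁻¹) (ℕₚ.+-suc m n) ⟨
    ((suc m ℕ.+ suc n) ·ℕ g) ⁻¹      ≈⟨ ⁻¹-cong (·ℕ-distribʳ-+ (suc m) (suc n) g) ⟩
    (suc m ·ℕ g ∙ suc n ·ℕ g) ⁻¹     ≈⟨ ⁻¹-∙-comm _ _ ⟨
    (suc m ·ℕ g) ⁻¹ ∙ (suc n ·ℕ g) ⁻¹ ∎

  ·-assoc : ∀ a b g → (a ℤ.* b) · g ≈ a · (b · g)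
  ·-assoc (ℤ.+ m)    b g = +-assoc m
    where
    +-assoc : ∀ m → ((ℤ.+ m) ℤ.* b) · g ≈ (ℤ.+ m) · (b · g)
    +-assoc zero    = refl
    +-assoc (suc m) = begin
      ((ℤ.+ suc m) ℤ.* b) · g        ≡⟨ ≡.cong (_· g) (ℤₚ.suc-* (ℤ.+ m) b) ⟩
      (b ℤ.+ (ℤ.+ m) ℤ.* b) · g      ≈⟨ ·-distribʳ-+ b ((ℤ.+ m) ℤ.* b) g ⟩
      b · g ∙ ((ℤ.+ m) ℤ.* b) · g    ≈⟨ ∙-congˡ (+-assoc m) ⟩
      b · g ∙ (ℤ.+ m) · (b · g)      ∎
  ·-assoc ℤ.-[1+ m ] b g = begin
    (ℤ.-[1+ m ] ℤ.* b) · g           ≡⟨ ≡.cong (_· g) (ℤₚ.neg-distribˡ-* (ℤ.+ suc m) b) ⟨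
    (- ((ℤ.+ suc m) ℤ.* b)) · g      ≈⟨ neg-· ((ℤ.+ suc m) ℤ.* b) g ⟩
    (((ℤ.+ suc m) ℤ.* b) · g) ⁻¹     ≈⟨ ⁻¹-cong (·-assoc (ℤ.+ suc m) b g) ⟩
    ℤ.-[1+ m ] · (b · g)             ∎

  ·-inverse : ∀ a g → a · (g ⁻¹) ≈ (a · g) ⁻¹
  ·-inverse a g = inverseʳ-unique (a · g) (a · (g ⁻¹))
    (trans (sym (·-distribˡ-∙ a g (g ⁻¹))) (trans (·-congˡ a (inverseʳ g)) (·-zeroʳ a)))

  ∑≡sum : ∀ {n} (f : Fin n → A) → ∑ f ≡ sum f
  ∑≡sum {zero}  f = ≡.refl
  ∑≡sum {suc n} f = ≡.cong (f zero ∙_) (∑≡sum (λ i → f (suc i)))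

  ∑-cong : ∀ {n} {f g : Fin n → A} → (∀ i → f i ≈ g i) → ∑ f ≈ ∑ g
  ∑-cong {zero}  f≈g = refl
  ∑-cong {suc n} f≈g = ∙-cong (f≈g zero) (∑-cong (λ i → f≈g (suc i)))

  ∑-zero : ∀ {n} {f : Fin n → A} → (∀ i → f i ≈ ε) → ∑ f ≈ ε
  ∑-zero {zero}  f≈ε = refl
  ∑-zero {suc n} f≈ε = trans (∙-cong (f≈ε zero) (∑-zero (λ i → f≈ε (suc i)))) (identityˡ ε)

  ∑-distrib-∙ : ∀ {n} (f g : Fin n → A) → ∑ (λ i → f i ∙ g i) ≈ ∑ f ∙ ∑ g
  ∑-distrib-∙ f g = begin
    ∑ (λ i → f i ∙ g i)     ≡⟨ ∑≡sum (λ i → f i ∙ g i) ⟩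
    sum (λ i → f i ∙ g i)   ≈⟨ ∑-distrib-+ f g ⟩
    sum f ∙ sum g           ≡⟨ ≡.cong₂ _∙_ (∑≡sum f) (∑≡sum g) ⟨
    ∑ f ∙ ∑ g               ∎

  ∑-swap : ∀ {m n} (f : Fin m → Fin n → A) → ∑ (λ i → ∑ (f i)) ≈ ∑ (λ j → ∑ (λ i → f i j))
  ∑-swap {zero} {n} f = sym (∑-zero {n} (λ _ → refl))
  ∑-swap {suc m} f = trans (∙-congˡ (∑-swap (λ i → f (suc i)))) (sym (∑-distrib-∙ (f zero) _))

  ·-distrib-∑ : ∀ {n} a (f : Fin n → A) → a · ∑ f ≈ ∑ (λ i → a · f i)
  ·-distrib-∑ {zero}  a f = ·-zeroʳ a
  ·-distrib-∑ {suc n} a f = trans (·-distribˡ-∙ a _ _) (∙-congˡ (·-distrib-∑ a (λ i → f (suc i))))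

  ∑ℤ-distrib-· : ∀ {n} (f : Fin n → ℤ) g → ∑ℤ f · g ≈ ∑ (λ i → f i · g)
  ∑ℤ-distrib-· {zero}  f g = refl
  ∑ℤ-distrib-· {suc n} f g = trans (·-distribʳ-+ (f zero) _ g) (∙-congˡ (∑ℤ-distrib-· (λ i → f (suc i)) g))

  ⁻¹-distrib-∑ : ∀ {n} (f : Fin n → A) → (∑ f) ⁻¹ ≈ ∑ (λ i → f i ⁻¹)
  ⁻¹-distrib-∑ {zero}  f = ε⁻¹≈ε
  ⁻¹-distrib-∑ {suc n} f = trans (sym (⁻¹-∙-comm _ _)) (∙-congˡ (⁻¹-distrib-∑ (λ i → f (suc i))))

  ∑-single : ∀ {n} (f : Fin n → A) b → (∀ a → a ≢ b → f a ≈ ε) → ∑ f ≈ f b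
  ∑-single f zero    f≈ε = trans (∙-congˡ (∑-zero (λ i → f≈ε (suc i) (λ ())))) (identityʳ _)
  ∑-single f (suc b) f≈ε = trans (∙-congʳ (f≈ε zero (λ ()))) (trans (identityˡ _)
    (∑-single (λ i → f (suc i)) b (λ a a≢b → f≈ε (suc a) (a≢b ∘ Finₚ.suc-injective))))

  ∑-δ : ∀ {n} (b : Fin n) (u : Fin n → A) → ∑ (λ a → δ b a · u a) ≈ u b
  ∑-δ b u = trans (∑-single (λ a → δ b a · u a) b (λ a a≢b → δ-offDiagonal a (a≢b ∘ ≡.sym))) δ-diagonal
    where
    δ-diagonal : δ b b · u b ≈ u b
    δ-diagonal with b Fin.≟ b
    ... | yes _   = ·-identityˡ (u b)
    ... | no b≢b = contradiction ≡.refl b≢b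
    δ-offDiagonal : ∀ a → b ≢ a → δ b a · u a ≈ ε
    δ-offDiagonal a b≢a with b Fin.≟ a
    ... | yes b≡a = contradiction b≡a b≢a
    ... | no _    = refl

  act-∘ : ∀ {p k l} (N : Mat p k) (Q : Mat k l) (y : Fin l → A) a →
          act N (act Q y) a ≈ ∑ (λ i → ∑ℤ (λ j → N a j ℤ.* Q j i) · y i)
  act-∘ N Q y a = begin
      ∑ (λ j → N a j · ∑ (λ i → Q j i · y i))
    ≈⟨ ∑-cong (λ j → trans (·-distrib-∑ (N a j) (λ i → Q j i · y i)) (∑-cong (λ i → sym (·-assoc (N a j) (Q j i) (y i))))) ⟩
      ∑ (λ j → ∑ (λ i → (N a j ℤ.* Q j i) · y i))
    ≈⟨ ∑-swap (λ j i → (N a j ℤ.* Q j i) · y i) ⟩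
      ∑ (λ i → ∑ (λ j → (N a j ℤ.* Q j i) · y i))
    ≈⟨ ∑-cong (λ i → sym (∑ℤ-distrib-· (λ j → N a j ℤ.* Q j i) (y i))) ⟩
      ∑ (λ i → ∑ℤ (λ j → N a j ℤ.* Q j i) · y i)
    ∎

  act-∙⁻¹ : ∀ {p k} (N : Mat p k) (f g : Fin k → A) a →
            act N (λ i → f i ∙ g i ⁻¹) a ≈ act N f a ∙ (act N g a) ⁻¹
  act-∙⁻¹ N f g a = begin
      ∑ (λ i → N a i · (f i ∙ g i ⁻¹))
    ≈⟨ ∑-cong (λ i → trans (·-distribˡ-∙ (N a i) (f i) (g i ⁻¹)) (∙-congˡ (·-inverse (N a i) (g i)))) ⟩
      ∑ (λ i → N a i · f i ∙ (N a i · g i) ⁻¹)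
    ≈⟨ ∑-distrib-∙ (λ i → N a i · f i) (λ i → (N a i · g i) ⁻¹) ⟩
      act N f a ∙ ∑ (λ i → (N a i · g i) ⁻¹)
    ≈⟨ ∙-congˡ (⁻¹-distrib-∑ (λ i → N a i · g i)) ⟨
      act N f a ∙ (act N g a) ⁻¹
    ∎

  unimodular-injective : ∀ {r} (B : Mat r r) → Unimodular B → (u : Fin r → A) →
                         (∀ a → act B u a ≈ ε) → ∀ b → u b ≈ ε
  unimodular-injective {r} B unimodular u Bu≈ε b with unimodular-leftInverse r B unimodular
  ... | L , LB≡I = begin
    u b                                           ≈⟨ ∑-δ b u ⟨
    ∑ (λ a → δ b a · u a)                         ≈⟨ ∑-cong (λ a → reflexive (≡.cong (_· u a) (LB≡I b a))) ⟨
    ∑ (λ a → ∑ℤ (λ l → L b l ℤ.* B l a) · u a)    ≈⟨ act-∘ L B u b ⟨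
    act L (act B u) b                             ≈⟨ ∑-zero (λ l → trans (·-congˡ (L b l) (Bu≈ε l)) (·-zeroʳ (L b l))) ⟩
    ε                                             ∎

module CyclicIndex {n : ℕ} where

  open ≡
  open import Data.Nat using (_+_)

  private
    m = suc n

  toℕ-addMod : ∀ (a : Fin m) t → toℕ (addMod a t) ≡ (toℕ a + t) % m
  toℕ-addMod a t = Finₚ.toℕ-fromℕ< (m%n<n (toℕ a + t) m)

  addMod-≡ : ∀ (a b : Fin m) s t → (toℕ a + s) % m ≡ (toℕ b + t) % m → addMod a s ≡ addMod b t
  addMod-≡ a b s t eq = Finₚ.toℕ-injective (trans (toℕ-addMod a s) (trans eq (sym (toℕ-addMod b t))))

  addMod-zero : ∀ (a : Fin m) → addMod a 0 ≡ a
  addMod-zero a = Finₚ.toℕ-injective (begin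
    toℕ (addMod a 0)     ≡⟨ toℕ-addMod a 0 ⟩
    (toℕ a + 0) % m      ≡⟨ cong (_% m) (ℕₚ.+-identityʳ (toℕ a)) ⟩
    toℕ a % m            ≡⟨ m<n⇒m%n≡m (Finₚ.toℕ<n a) ⟩
    toℕ a                ∎)
    where open ≡-Reasoning

  addMod-addMod : ∀ (a : Fin m) s t → addMod (addMod a s) t ≡ addMod a (s + t)
  addMod-addMod a s t = addMod-≡ (addMod a s) a t (s + t) (begin
    (toℕ (addMod a s) + t) % m         ≡⟨ cong (λ x → (x + t) % m) (toℕ-addMod a s) ⟩
    ((toℕ a + s) % m + t) % m          ≡⟨ %-distribˡ-+ ((toℕ a + s) % m) t m ⟩
    ((toℕ a + s) % m % m + t % m) % m  ≡⟨ cong (λ x → (x + t % m) % m) (m%n%n≡m%n (toℕ a + s) m) ⟩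
    ((toℕ a + s) % m + t % m) % m      ≡⟨ %-distribˡ-+ (toℕ a + s) t m ⟨
    (toℕ a + s + t) % m                ≡⟨ cong (_% m) (ℕₚ.+-assoc (toℕ a) s t) ⟩
    (toℕ a + (s + t)) % m              ∎)
    where open ≡-Reasoning

  addMod-+m : ∀ (a : Fin m) t → addMod a (t + m) ≡ addMod a t
  addMod-+m a t = addMod-≡ a a (t + m) t
    (trans (cong (_% m) (sym (ℕₚ.+-assoc (toℕ a) t m))) ([m+n]%n≡m%n (toℕ a + t) m))

  addMod-m : ∀ (a : Fin m) → addMod a m ≡ a
  addMod-m a = trans (addMod-+m a 0) (addMod-zero a)

  addMod-toℕ-comm : ∀ (a b : Fin m) → addMod a (toℕ b) ≡ addMod b (toℕ a)
  addMod-toℕ-comm a b = addMod-≡ a b (toℕ b) (toℕ a) (cong (_% m) (ℕₚ.+-comm (toℕ a) (toℕ b)))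

  -- the cyclic distance from a to b: the t < m with b = a + t (mod m)
  dist : Fin m → Fin m → ℕ
  dist a b = toℕ (addMod b (m ∸ toℕ a))

  dist<m : ∀ a b → dist a b < m
  dist<m a b = Finₚ.toℕ<n (addMod b (m ∸ toℕ a))

  addMod-dist : ∀ a b → addMod a (dist a b) ≡ b
  addMod-dist a b = begin
    addMod a (toℕ (addMod b (m ∸ toℕ a)))  ≡⟨ addMod-toℕ-comm a (addMod b (m ∸ toℕ a)) ⟩
    addMod (addMod b (m ∸ toℕ a)) (toℕ a)  ≡⟨ addMod-addMod b (m ∸ toℕ a) (toℕ a) ⟩
    addMod b (m ∸ toℕ a + toℕ a)           ≡⟨ cong (addMod b) (ℕₚ.m∸n+n≡m (ℕₚ.<⇒≤ (Finₚ.toℕ<n a))) ⟩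
    addMod b m                             ≡⟨ addMod-m b ⟩
    b                                      ∎
    where open ≡-Reasoning

  dist-addMod-% : ∀ a t → dist a (addMod a t) ≡ t % m
  dist-addMod-% a t = begin
    toℕ (addMod (addMod a t) (m ∸ toℕ a))  ≡⟨ cong toℕ (addMod-addMod a t (m ∸ toℕ a)) ⟩
    toℕ (addMod a (t + (m ∸ toℕ a)))       ≡⟨ toℕ-addMod a (t + (m ∸ toℕ a)) ⟩
    (toℕ a + (t + (m ∸ toℕ a))) % m        ≡⟨ cong (_% m) (arith (toℕ a) (ℕₚ.<⇒≤ (Finₚ.toℕ<n a))) ⟩
    (t + m) % m                            ≡⟨ [m+n]%n≡m%n t m ⟩
    t % m                                  ∎
    where
    open ≡-Reasoning
    arith : ∀ x → x ≤ m → x + (t + (m ∸ x)) ≡ t + m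
    arith x x≤m = begin
      x + (t + (m ∸ x))  ≡⟨ cong (x +_) (ℕₚ.+-comm t (m ∸ x)) ⟩
      x + ((m ∸ x) + t)  ≡⟨ ℕₚ.+-assoc x (m ∸ x) t ⟨
      x + (m ∸ x) + t    ≡⟨ cong (_+ t) (ℕₚ.m+[n∸m]≡n x≤m) ⟩
      m + t              ≡⟨ ℕₚ.+-comm m t ⟩
      t + m              ∎

  dist-addMod : ∀ a {t} → t < m → dist a (addMod a t) ≡ t
  dist-addMod a {t} t<m = trans (dist-addMod-% a t) (m<n⇒m%n≡m t<m)

  dist-unique : ∀ a b {t} → addMod a t ≡ b → t < m → dist a b ≡ t
  dist-unique a b {t} a+t≡b t<m = trans (cong (dist a) (sym a+t≡b)) (dist-addMod a t<m)

open CyclicIndex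

module CyclicSum {c ℓ : Level} (CM : CommutativeMonoid c ℓ) where

  open import Data.Nat using (_+_)
  open CommutativeMonoid CM renaming (Carrier to C)
  open import Algebra.Properties.CommutativeMonoid.Sum CM using (sum-permute)
  open import Algebra.Properties.CommutativeMonoid.Sum CM public using (sum)
  open import Data.Fin.Permutation using (permutation)
  open import Relation.Binary.Reasoning.Setoid setoid

  sumℕ : ℕ → (ℕ → C) → C
  sumℕ zero    g = ε
  sumℕ (suc k) g = g 0 ∙ sumℕ k (λ t → g (suc t))

  sum≡sumℕ : ∀ k (g : ℕ → C) → sum {k} (λ t → g (toℕ t)) ≡ sumℕ k g
  sum≡sumℕ zero    g = ≡.refl
  sum≡sumℕ (suc k) g = ≡.cong (g 0 ∙_) (sum≡sumℕ k (λ t → g (suc t)))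

  sumℕ-cong : ∀ k {g h : ℕ → C} → (∀ t → t < k → g t ≈ h t) → sumℕ k g ≈ sumℕ k h
  sumℕ-cong zero    g≈h = refl
  sumℕ-cong (suc k) g≈h = ∙-cong (g≈h 0 (s≤s z≤n)) (sumℕ-cong k (λ t t<k → g≈h (suc t) (s≤s t<k)))

  sumℕ-zero : ∀ k {g : ℕ → C} → (∀ t → t < k → g t ≈ ε) → sumℕ k g ≈ ε
  sumℕ-zero k g≈ε = trans (sumℕ-cong k g≈ε) (ε-sum k)
    where
    ε-sum : ∀ k → sumℕ k (λ _ → ε) ≈ ε
    ε-sum zero    = refl
    ε-sum (suc k) = trans (identityˡ _) (ε-sum k)

  sumℕ-+ : ∀ p q (g : ℕ → C) → sumℕ (p + q) g ≈ sumℕ p g ∙ sumℕ q (λ t → g (p + t))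
  sumℕ-+ zero    q g = sym (identityˡ _)
  sumℕ-+ (suc p) q g = trans (∙-congˡ (sumℕ-+ p q (λ t → g (suc t)))) (sym (assoc _ _ _))

  sumℕ-suc : ∀ k (g : ℕ → C) → sumℕ (suc k) g ≈ sumℕ k g ∙ g k
  sumℕ-suc k g = begin
    sumℕ (suc k) g            ≡⟨ ≡.cong (λ k → sumℕ k g) (ℕₚ.+-comm 1 k) ⟩
    sumℕ (k + 1) g            ≈⟨ sumℕ-+ k 1 g ⟩
    sumℕ k g ∙ (g (k + 0) ∙ ε) ≈⟨ ∙-congˡ (trans (identityʳ _) (reflexive (≡.cong g (ℕₚ.+-identityʳ k)))) ⟩
    sumℕ k g ∙ g k            ∎

  sum-rotate : ∀ {n} (f : Fin (suc n) → C) a → sum f ≈ sumℕ (suc n) (λ t → f (addMod a t))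
  sum-rotate {n} f a = begin
    sum f                                    ≈⟨ sum-permute f rotation ⟩
    sum {suc n} (λ t → f (addMod a (toℕ t))) ≡⟨ sum≡sumℕ (suc n) (λ t → f (addMod a t)) ⟩
    sumℕ (suc n) (λ t → f (addMod a t))      ∎
    where
    rotation = permutation {m = suc n} (λ t → addMod a (toℕ t)) (λ b → fromℕ< (dist<m a b))
      (λ b → ≡.trans (≡.cong (addMod a) (Finₚ.toℕ-fromℕ< (dist<m a b))) (addMod-dist a b))
      (λ t → Finₚ.toℕ-injective (≡.trans (Finₚ.toℕ-fromℕ< (dist<m a (addMod a (toℕ t)))) (dist-addMod a (Finₚ.toℕ<n t))))

  sum-arc : ∀ {n} (f : Fin (suc n) → C) a s k → s + k ≤ suc n →
            (∀ t → t < suc n → t < s ⊎ s + k ≤ t → f (addMod a t) ≈ ε) →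
            sum f ≈ sumℕ k (λ t → f (addMod a (s + t)))
  sum-arc {n} f a s k s+k≤m outside≈ε = begin
    sum f                                        ≈⟨ sum-rotate f a ⟩
    sumℕ (suc n) g                               ≡⟨ ≡.cong (λ l → sumℕ l g) m≡s+[k+q] ⟩
    sumℕ (s + (k + q)) g                         ≈⟨ sumℕ-+ s (k + q) g ⟩
    sumℕ s g ∙ sumℕ (k + q) (λ t → g (s + t))    ≈⟨ ∙-congˡ (sumℕ-+ k q (λ t → g (s + t))) ⟩
    sumℕ s g ∙ (arc ∙ rest)                      ≈⟨ ∙-cong (sumℕ-zero s before) (∙-congˡ (sumℕ-zero q after)) ⟩
    ε ∙ (arc ∙ ε)                                ≈⟨ trans (identityˡ _) (identityʳ _) ⟩
    arc                                          ∎
    where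
    g : ℕ → C
    g t = f (addMod a t)
    q = suc n ∸ (s + k)
    arc = sumℕ k (λ t → g (s + t))
    rest = sumℕ q (λ t → g (s + (k + t)))
    m≡s+[k+q] : suc n ≡ s + (k + q)
    m≡s+[k+q] = ≡.trans (≡.sym (ℕₚ.m+[n∸m]≡n s+k≤m)) (ℕₚ.+-assoc s k q)
    before : ∀ t → t < s → g t ≈ ε
    before t t<s = outside≈ε t (ℕₚ.<-≤-trans t<s (ℕₚ.≤-trans (ℕₚ.m≤m+n s k) s+k≤m)) (inj₁ t<s)
    after : ∀ t → t < q → g (s + (k + t)) ≈ ε
    after t t<q = outside≈ε (s + (k + t))
      (≡.subst (s + (k + t) <_) (≡.sym m≡s+[k+q]) (ℕₚ.+-monoʳ-< s (ℕₚ.+-monoʳ-< k t<q)))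
      (inj₂ (ℕₚ.+-monoʳ-≤ s (ℕₚ.m≤m+n k t)))

module ℕSum = CyclicSum ℕₚ.+-0-commutativeMonoid

module CsetProperties {n : ℕ} (r : ℕ) where

  open ≡
  open import Data.Nat using (_+_)
  open import Data.Vec using ([]; _∷_; lookup)
  open import Data.Vec.Properties using (lookup∘tabulate; []=⇒lookup; lookup⇒[]=)
  open ℕSum using (sum)

  private
    m = suc n

    InArc : Fin m → Fin m → Set
    InArc j i = Σ (Fin (suc r)) λ s → i ≡ addMod j (toℕ s)

    inArc? : ∀ j i → Dec (InArc j i)
    inArc? j i = Finₚ.any? (λ s → i Finₚ.≟ addMod j (toℕ s))

    lookup-Cset : ∀ j i → lookup (Cset r j) i ≡ does (inArc? j i)
    lookup-Cset j i = lookup∘tabulate (λ i → does (inArc? j i)) i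

    witness : ∀ {a} {P : Set a} (d : Dec P) → does d ≡ true → P
    witness (yes p) _ = p

  ∈Cset⇒dist≤ : ∀ j i → i ∈ Cset r j → dist j i ≤ r
  ∈Cset⇒dist≤ j i i∈C with witness (inArc? j i) (trans (sym (lookup-Cset j i)) ([]=⇒lookup i∈C))
  ... | s , i≡j+s = begin
    dist j i                   ≡⟨ cong (dist j) i≡j+s ⟩
    dist j (addMod j (toℕ s))  ≡⟨ dist-addMod-% j (toℕ s) ⟩
    toℕ s ℕ.% m                ≤⟨ m%n≤m (toℕ s) m ⟩
    toℕ s                      ≤⟨ ℕ.s≤s⁻¹ (Finₚ.toℕ<n s) ⟩
    r                          ∎
    where open ℕₚ.≤-Reasoning

  dist≤⇒∈Cset : ∀ j i → dist j i ≤ r → i ∈ Cset r j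
  dist≤⇒∈Cset j i d≤r = lookup⇒[]= i (Cset r j) (trans (lookup-Cset j i) (dec-true (inArc? j i) (s , i≡j+s)))
    where
    s = fromℕ< (s≤s d≤r)
    i≡j+s : i ≡ addMod j (toℕ s)
    i≡j+s = sym (trans (cong (addMod j) (Finₚ.toℕ-fromℕ< (s≤s d≤r))) (addMod-dist j i))

  addMod∈Cset : ∀ j {t} → t ≤ r → t < m → addMod j t ∈ Cset r j
  addMod∈Cset j {t} t≤r t<m = dist≤⇒∈Cset j (addMod j t) (subst (_≤ r) (sym (dist-addMod j t<m)) t≤r)

  addMod∉Cset : ∀ j {t} → r < t → t < m → addMod j t ∈ Cset r j → ⊥
  addMod∉Cset j {t} r<t t<m t∈C = ℕₚ.<⇒≱ r<t (subst (_≤ r) (dist-addMod j t<m) (∈Cset⇒dist≤ j (addMod j t) t∈C))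

  private
    indicator : Bool → ℕ
    indicator true  = 1
    indicator false = 0

    ∣p∣≡sum : ∀ {k} (p : Subset k) → ∣ p ∣ ≡ sum (λ i → indicator (lookup p i))
    ∣p∣≡sum []          = refl
    ∣p∣≡sum (true ∷ p)  = cong suc (∣p∣≡sum p)
    ∣p∣≡sum (false ∷ p) = ∣p∣≡sum p

    lookup≢true : ∀ {k} (p : Subset k) i → ¬ i ∈ p → lookup p i ≡ false
    lookup≢true p i i∉p with lookup p i in eq
    ... | true  = contradiction (lookup⇒[]= i p eq) i∉p
    ... | false = refl

    sumℕ-ones : ∀ k → ℕSum.sumℕ k (λ _ → 1) ≡ k
    sumℕ-ones zero    = refl
    sumℕ-ones (suc k) = cong suc (sumℕ-ones k)

  Cset-size : suc r ≤ m → ∀ j → ∣ Cset r j ∣ ≡ suc r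
  Cset-size r<m j = begin
    ∣ Cset r j ∣                          ≡⟨ ∣p∣≡sum (Cset r j) ⟩
    sum (λ i → indicator (lookup (Cset r j) i))
      ≡⟨ ℕSum.sum-arc (λ i → indicator (lookup (Cset r j) i)) j 0 (suc r) r<m outside ⟩
    ℕSum.sumℕ (suc r) (λ t → indicator (lookup (Cset r j) (addMod j t)))
      ≡⟨ ℕSum.sumℕ-cong (suc r) inside ⟩
    ℕSum.sumℕ (suc r) (λ _ → 1)          ≡⟨ sumℕ-ones (suc r) ⟩
    suc r                                 ∎
    where
    open ≡-Reasoning
    outside : ∀ t → t < m → t < 0 ⊎ suc r ≤ t → indicator (lookup (Cset r j) (addMod j t)) ≡ 0
    outside t t<m (inj₂ r<t) = cong indicator (lookup≢true (Cset r j) (addMod j t) (addMod∉Cset j r<t t<m))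
    inside : ∀ t → t < suc r → indicator (lookup (Cset r j) (addMod j t)) ≡ 1
    inside t t≤r = cong indicator ([]=⇒lookup (addMod∈Cset j (ℕ.s≤s⁻¹ t≤r) (ℕₚ.<-≤-trans t≤r r<m)))

  Cset-injective : suc r < m → ∀ j j′ → j ≢ j′ → Cset r j ≢ Cset r j′
  Cset-injective r+1<m j j′ j≢j′ Cj≡Cj′ = byCases (d + r ℕₚ.<? m)
    where
    d = dist j j′
    d≢0 : d ≢ 0
    d≢0 d≡0 = j≢j′ (trans (sym (addMod-zero j)) (trans (cong (addMod j) (sym d≡0)) (addMod-dist j j′)))
    -- j′ + t = j + (d + t) lies in C_{j′} but not in C_j
    separatedBy : ∀ t → t ≤ r → r < d + t → d + t < m → ⊥
    separatedBy t t≤r r<d+t d+t<m = addMod∉Cset j r<d+t d+t<m (subst (addMod j (d + t) ∈_) (sym Cj≡Cj′) j′+t∈Cj′)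
      where
      j′+t∈Cj′ : addMod j (d + t) ∈ Cset r j′
      j′+t∈Cj′ = subst (_∈ Cset r j′) (trans (cong (λ k → addMod k t) (sym (addMod-dist j j′))) (addMod-addMod j d t))
                       (addMod∈Cset j′ t≤r (ℕₚ.≤-<-trans (ℕₚ.m≤n+m t d) d+t<m))
    d+[n∸d]≡n : d + (n ∸ d) ≡ n
    d+[n∸d]≡n = ℕₚ.m+[n∸m]≡n (ℕ.s≤s⁻¹ (dist<m j j′))
    byCases : Dec (d + r < m) → ⊥
    byCases (yes d+r<m) = separatedBy r ℕₚ.≤-refl (ℕₚ.+-monoˡ-< r (ℕₚ.n≢0⇒n>0 d≢0)) d+r<m
    byCases (no  d+r≮m) = separatedBy (n ∸ d) (ℕₚ.m≤n+o⇒m∸n≤o n d (ℕₚ.<⇒≤ (ℕₚ.≮⇒≥ d+r≮m)))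
                                      (subst (r <_) (sym d+[n∸d]≡n) (ℕ.s≤s⁻¹ r+1<m))
                                      (subst (_< m) (sym d+[n∸d]≡n) ℕₚ.≤-refl)

open CsetProperties

module ℤSum = CyclicSum ℤₚ.+-0-commutativeMonoid

padWithZeros : ∀ {k} → (Fin k → ℤ) → ℕ → ℤ
padWithZeros {k} v t with t ℕₚ.<? k
... | yes t<k = v (fromℕ< t<k)
... | no  _   = 0ℤ

padWithZeros-toℕ : ∀ {k} (v : Fin k → ℤ) s → padWithZeros v (toℕ s) ≡ v s
padWithZeros-toℕ {k} v s with toℕ s ℕₚ.<? k
... | yes s<k = ≡.cong v (Finₚ.fromℕ<-toℕ s s<k)
... | no  s≮k = ⊥-elim (s≮k (Finₚ.toℕ<n s))

padWithZeros-≥ : ∀ {k} (v : Fin k → ℤ) {t} → k ≤ t → padWithZeros v t ≡ 0ℤ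
padWithZeros-≥ {k} v {t} k≤t with t ℕₚ.<? k
... | yes t<k = ⊥-elim (ℕₚ.<⇒≱ t<k k≤t)
... | no  _   = ≡.refl

module Construction {n : ℕ} (r : ℕ) (M : Mat r (suc n)) (r<m : r < suc n) where

  open ≡
  open ≡-Reasoning
  open import Data.Nat using (_+_)
  open ℕ-Solver using (solve-∀)
  open ℤSum using (sum)

  private
    m = suc n
    r≤m : r ≤ m
    r≤m = ℕₚ.<⇒≤ r<m

  -- columns i - r, …, i of M
  block : Fin m → Mat r (suc r)
  block i a s = M a (addMod i (m ∸ r + toℕ s))

  start : Fin m → Fin m
  start i = addMod i (m ∸ r)

  -- Column i of Ψ is the cofactor vector of block i, placed in rows i - r, …, i.
  Ψ : Mat m m
  Ψ j i = padWithZeros (cofactor (block i)) (dist (start i) j)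

  M·Ψ≡0 : ∀ a i → ∑ℤ (λ j → M a j * Ψ j i) ≡ 0ℤ
  M·Ψ≡0 a i = begin
      ∑ℤ (λ j → M a j * Ψ j i)
    ≡⟨ ∑ℤ≡sum (λ j → M a j * Ψ j i) ⟩
      sum (λ j → M a j * Ψ j i)
    ≡⟨ ℤSum.sum-arc (λ j → M a j * Ψ j i) (start i) 0 (suc r) r<m outside ⟩
      ℤSum.sumℕ (suc r) (λ t → M a (addMod (start i) t) * Ψ (addMod (start i) t) i)
    ≡⟨ ℤSum.sum≡sumℕ (suc r) (λ t → M a (addMod (start i) t) * Ψ (addMod (start i) t) i) ⟨
      sum {suc r} (λ s → M a (addMod (start i) (toℕ s)) * Ψ (addMod (start i) (toℕ s)) i)
    ≡⟨ ∑ℤ≡sum {suc r} (λ s → M a (addMod (start i) (toℕ s)) * Ψ (addMod (start i) (toℕ s)) i) ⟨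
      ∑ℤ {suc r} (λ s → M a (addMod (start i) (toℕ s)) * Ψ (addMod (start i) (toℕ s)) i)
    ≡⟨ ∑ℤ-cong {suc r} (λ s → cong₂ _*_ (cong (M a) (addMod-addMod i (m ∸ r) (toℕ s))) (column-entry s)) ⟩
      ∑ℤ (λ s → block i a s * cofactor (block i) s)
    ≡⟨ cofactor-orthogonal (block i) a ⟩
      0ℤ
    ∎
    where
    column-entry : ∀ s → Ψ (addMod (start i) (toℕ s)) i ≡ cofactor (block i) s
    column-entry s = trans (cong (padWithZeros (cofactor (block i))) (dist-addMod (start i) (ℕₚ.<-≤-trans (Finₚ.toℕ<n s) r<m)))
                           (padWithZeros-toℕ (cofactor (block i)) s)
    outside : ∀ t → t < m → t < 0 ⊎ suc r ≤ t → M a (addMod (start i) t) * Ψ (addMod (start i) t) i ≡ 0ℤ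
    outside t t<m (inj₂ r<t) = trans (cong (M a (addMod (start i) t) *_)
      (trans (cong (padWithZeros (cofactor (block i))) (dist-addMod (start i) t<m)) (padWithZeros-≥ (cofactor (block i)) r<t)))
      (ℤₚ.*-zeroʳ (M a (addMod (start i) t)))

  private
    start-addMod : ∀ j t x → addMod (start (addMod j t)) x ≡ addMod j (t + (m ∸ r) + x)
    start-addMod j t x = trans (cong (λ k → addMod k x) (addMod-addMod j t (m ∸ r))) (addMod-addMod j (t + (m ∸ r)) x)

    dist-start : ∀ j t x → x < m → addMod j (t + (m ∸ r) + x) ≡ j → dist (start (addMod j t)) j ≡ x
    dist-start j t x x<m wraps = dist-unique (start (addMod j t)) j (trans (start-addMod j t x) wraps) x<m

  Ψ-row-last : ∀ j → Ψ j (addMod j r) ≡ cofactor (block (addMod j r)) zero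
  Ψ-row-last j = cong (padWithZeros (cofactor (block (addMod j r))))
    (dist-start j r 0 (s≤s z≤n) (trans (cong (addMod j) (trans (ℕₚ.+-identityʳ _) (ℕₚ.m+[n∸m]≡n r≤m))) (addMod-m j)))

  -- Row j sits at offset x = m + r - t > r of column j + t.
  Ψ-row-outside : ∀ j {t} → r < t → t < m → Ψ j (addMod j t) ≡ 0ℤ
  Ψ-row-outside j {t} r<t t<m with ℕₚ.m≤n⇒∃[o]m+o≡n r<t
  ... | u , r+1+u≡t = trans (cong (padWithZeros (cofactor (block (addMod j t)))) (dist-start j t x x<m wraps))
                            (padWithZeros-≥ (cofactor (block (addMod j t))) r<x)
    where
    x = m ∸ suc u
    1+u≤m : suc u ≤ m
    1+u≤m = ℕₚ.≤-trans (ℕₚ.m≤n+m (suc u) r) (ℕₚ.≤-trans (ℕₚ.≤-reflexive (trans (ℕₚ.+-suc r u) r+1+u≡t)) (ℕₚ.<⇒≤ t<m))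
    x<m : x < m
    x<m = ℕₚ.∸-monoʳ-< (s≤s z≤n) 1+u≤m
    r<x : suc r ≤ x
    r<x = ℕₚ.m+n≤o⇒m≤o∸n (suc r) (subst (_≤ m) (sym (trans (ℕₚ.+-suc (suc r) u) (cong suc r+1+u≡t))) t<m)
    sum≡m+m : t + (m ∸ r) + x ≡ m + m
    sum≡m+m = begin
      t + (m ∸ r) + x                           ≡⟨ cong (λ t → t + (m ∸ r) + x) (sym r+1+u≡t) ⟩
      suc r + u + (m ∸ r) + (m ∸ suc u)         ≡⟨ regroup r u (m ∸ r) (m ∸ suc u) ⟩
      (r + (m ∸ r)) + (suc u + (m ∸ suc u))     ≡⟨ cong₂ _+_ (ℕₚ.m+[n∸m]≡n r≤m) (ℕₚ.m+[n∸m]≡n 1+u≤m) ⟩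
      m + m                                     ∎
      where
      regroup : ∀ r u a b → suc r + u + a + b ≡ (r + a) + (suc u + b)
      regroup = solve-∀
    wraps : addMod j (t + (m ∸ r) + x) ≡ j
    wraps = trans (cong (addMod j) sum≡m+m) (trans (addMod-+m j m) (addMod-m j))

  module _ (circular : Circular M) where

    Ψ-row-last-unit : ∀ j → IsUnit (Ψ j (addMod j r))
    Ψ-row-last-unit j = subst IsUnit (sym (trans (Ψ-row-last j) cofactor≡))
      (unit-* (sgn 0) (det r (subCols M i+1)) (sgn-unit 0) (unimodular⇒unit-det (subCols M i+1) (circular i+1)))
      where
      i = addMod j r
      i+1 = addMod i 1
      cofactor≡ : cofactor (block i) zero ≡ sgn 0 * det r (subCols M i+1)
      cofactor≡ = cong (sgn 0 *_) (det-cong r (λ a l → cong (M a)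
        (trans (cong (addMod i) (ℕₚ.+-suc (m ∸ r) (toℕ l))) (sym (addMod-addMod i 1 (m ∸ r + toℕ l))))))

module Representation {n : ℕ} (r : ℕ) (M : Mat r (suc n)) (r<n : r < n) (circular : Circular M)
                      {c ℓ : Level} (G : AbelianGroup c ℓ) where

  open import Data.Nat using (_+_)
  open ℕ-Solver using (solve-∀)
  open import Data.Product using (_×_)

  private
    m = suc n
    r<m : r < m
    r<m = ℕₚ.m<n⇒m<1+n r<n

  open Construction r M r<m
  open ZModule G
  open AbelianGroup G renaming (Carrier to A)
  open import Algebra.Properties.AbelianGroup G using (xyx⁻¹≈y)
  open import Algebra.Properties.Group group using (x∙y⁻¹≈ε⇒x≈y; x≈y⇒x∙y⁻¹≈ε)
  open import Relation.Binary.Reasoning.Setoid setoid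
  module GSum = CyclicSum commutativeMonoid
  open GSum using (sum; sumℕ)

  ψ : Fin m → (Fin m → A) → A
  ψ j y = act Ψ y j

  ψ-row-expansion : ∀ j y → ψ j y ≈ sumℕ (suc r) (λ t → Ψ j (addMod j t) · y (addMod j t))
  ψ-row-expansion j y = begin
    act Ψ y j                 ≡⟨ ∑≡sum (λ i → Ψ j i · y i) ⟩
    sum (λ i → Ψ j i · y i)   ≈⟨ GSum.sum-arc (λ i → Ψ j i · y i) j 0 (suc r) r<m outside ⟩
    sumℕ (suc r) (λ t → Ψ j (addMod j t) · y (addMod j t)) ∎
    where
    outside : ∀ t → t < m → t < 0 ⊎ suc r ≤ t → Ψ j (addMod j t) · y (addMod j t) ≈ ε
    outside t t<m (inj₂ r<t) = reflexive (≡.cong (_· y (addMod j t)) (Ψ-row-outside j r<t t<m))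

  Ψ-outside-Cset : ∀ j i → ¬ i ∈ Cset r j → Ψ j i ≡ 0ℤ
  Ψ-outside-Cset j i i∉C = ≡.trans (≡.cong (Ψ j) (≡.sym (addMod-dist j i)))
    (Ψ-row-outside j (ℕₚ.≰⇒> (i∉C ∘ dist≤⇒∈Cset r j i)) (dist<m j i))

  ψ-local : ∀ j {x x′ : Fin m → A} → (∀ i → i ∈ Cset r j → x i ≈ x′ i) → ψ j x ≈ ψ j x′
  ψ-local j {x} {x′} x≈x′ = ∑-cong term
    where
    term : ∀ i → Ψ j i · x i ≈ Ψ j i · x′ i
    term i with i ∈? Cset r j
    ... | yes i∈C = ·-congˡ (Ψ j i) (x≈x′ i i∈C)
    ... | no  i∉C = reflexive (≡.trans (≡.cong (_· x i) (Ψ-outside-Cset j i i∉C))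
                                        (≡.cong (_· x′ i) (≡.sym (Ψ-outside-Cset j i i∉C))))

  -- The other r coordinates form a vector killed by the unimodular block M₍ⱼ₎.
  ker-vanishing-on-arc : ∀ j (x : Fin m → A) → InKer G M x →
                         (∀ t → t < m ∸ r → x (addMod j t) ≈ ε) → ∀ i → x i ≈ ε
  ker-vanishing-on-arc j x Mx≈ε arc≈ε i = byCases (dist j i ℕₚ.<? m ∸ r)
    where
    u : Fin r → A
    u b = x (addMod j (m ∸ r + toℕ b))
    m∸r+r≡m : m ∸ r + r ≡ m
    m∸r+r≡m = ℕₚ.m∸n+n≡m (ℕₚ.<⇒≤ r<m)
    block-kills-u : ∀ a → act (subCols M j) u a ≈ ε
    block-kills-u a = begin
      act (subCols M j) u a                         ≡⟨ ∑≡sum {r} (λ b → g (addMod j (m ∸ r + toℕ b))) ⟩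
      sum {r} (λ b → g (addMod j (m ∸ r + toℕ b)))  ≡⟨ GSum.sum≡sumℕ r (λ t → g (addMod j (m ∸ r + t))) ⟩
      sumℕ r (λ t → g (addMod j (m ∸ r + t)))       ≈⟨ GSum.sum-arc g j (m ∸ r) r (ℕₚ.≤-reflexive m∸r+r≡m) outside ⟨
      sum g                                         ≡⟨ ∑≡sum g ⟨
      act M x a                                     ≈⟨ Mx≈ε a ⟩
      ε                                             ∎
      where
      g : Fin m → A
      g i = M a i · x i
      outside : ∀ t → t < m → t < m ∸ r ⊎ m ∸ r + r ≤ t → g (addMod j t) ≈ ε
      outside t t<m (inj₁ t<m∸r) = trans (·-congˡ (M a (addMod j t)) (arc≈ε t t<m∸r)) (·-zeroʳ (M a (addMod j t)))
      outside t t<m (inj₂ m≤t)   = contradiction (≡.subst (_≤ t) m∸r+r≡m m≤t) (ℕₚ.<⇒≱ t<m)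
    u≈ε : ∀ b → u b ≈ ε
    u≈ε = unimodular-injective (subCols M j) (circular j) u block-kills-u
    byCases : Dec (dist j i < m ∸ r) → x i ≈ ε
    byCases (yes d<m∸r) = trans (reflexive (≡.cong x (≡.sym (addMod-dist j i)))) (arc≈ε (dist j i) d<m∸r)
    byCases (no  d≮m∸r) = trans (reflexive (≡.cong x (≡.sym i≡))) (u≈ε b)
      where
      m∸r≤d : m ∸ r ≤ dist j i
      m∸r≤d = ℕₚ.≮⇒≥ d≮m∸r
      b<r : dist j i ∸ (m ∸ r) < r
      b<r = ℕₚ.+-cancelˡ-< (m ∸ r) _ _ (≡.subst₂ _<_ (≡.sym (ℕₚ.m+[n∸m]≡n m∸r≤d)) (≡.sym m∸r+r≡m) (dist<m j i))
      b = fromℕ< b<r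
      i≡ : addMod j (m ∸ r + toℕ b) ≡ i
      i≡ = ≡.trans (≡.cong (λ k → addMod j (m ∸ r + k)) (Finₚ.toℕ-fromℕ< b<r))
                   (≡.trans (≡.cong (addMod j) (ℕₚ.m+[n∸m]≡n m∸r≤d)) (addMod-dist j i))

  unit-cancel : ∀ x g → IsUnit x → x · (x · g) ≈ g
  unit-cancel x g x²≡1 = trans (sym (·-assoc x x g)) (trans (reflexive (≡.cong (_· g) x²≡1)) (·-identityˡ g))

  -- Row k = j + s + e involves coordinates k, …, k + r, and its coefficient at k + r
  -- is a unit; so the coordinates at offsets s + r, s + r + 1, … can be chosen one
  -- after another to give rows j + s, j + s + 1, … any prescribed values, leaving
  -- the coordinates at offsets below s + r as they were.
  module Extension (j : Fin m) (s L : ℕ) (s+r+L≤m : s + (r + L) ≤ m)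
                   (x₀ : Fin m → A) (target : ℕ → A) where

    row : ℕ → Fin m
    row e = addMod j (s + e)

    coeff : ℕ → ℕ → ℤ
    coeff e t = Ψ (row e) (addMod (row e) t)

    -- approx e q: the coordinate at offset q once rows 0, …, e - 1 are solved
    approx : ℕ → ℕ → A
    partial : ℕ → A
    next : ℕ → A

    approx zero    q = x₀ (addMod j q)
    approx (suc e) q with q ℕ.≟ s + r + e
    ... | yes _ = next e
    ... | no  _ = approx e q

    partial e = sumℕ r (λ t → coeff e t · approx e (s + e + t))

    next e = coeff e r · (target e ∙ partial e ⁻¹)

    approx-next : ∀ e → approx (suc e) (s + r + e) ≡ next e
    approx-next e with s + r + e ℕ.≟ s + r + e
    ... | yes _ = ≡.refl
    ... | no  q≢q = contradiction ≡.refl q≢q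

    approx-stable : ∀ d {e q} → q < s + r + e → approx (d + e) q ≡ approx e q
    approx-stable zero    q<s+r+e = ≡.refl
    approx-stable (suc d) {e} {q} q<s+r+e with q ℕ.≟ s + r + (d + e)
    ... | yes q≡ = contradiction (ℕₚ.≤-trans (ℕₚ.+-monoʳ-≤ (s + r) (ℕₚ.m≤n+m e d)) (ℕₚ.≤-reflexive (≡.sym q≡)))
                                 (ℕₚ.<⇒≱ q<s+r+e)
    ... | no  _  = approx-stable d q<s+r+e

    y : Fin m → A
    y i = approx L (dist j i)

    approx-final : ∀ {e q} → e ≤ L → q < s + r + e → approx L q ≡ approx e q
    approx-final {e} e≤L q<s+r+e = ≡.trans (≡.cong (λ k → approx k _) (≡.sym (ℕₚ.m∸n+n≡m e≤L))) (approx-stable (L ∸ e) q<s+r+e)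

    y-agrees : ∀ i → dist j i < s + r → y i ≡ x₀ i
    y-agrees i d<s+r = ≡.trans (approx-final z≤n (≡.subst (dist j i <_) (≡.sym (ℕₚ.+-identityʳ (s + r))) d<s+r))
                               (≡.cong x₀ (addMod-dist j i))

    private
      s+e+r≡s+r+e : ∀ e → s + e + r ≡ s + r + e
      s+e+r≡s+r+e e = rearrange s e r
        where rearrange : ∀ s e r → s + e + r ≡ s + r + e
              rearrange = solve-∀

    y-row : ∀ {e t} → e < L → t ≤ r → y (addMod (row e) t) ≡ approx L (s + e + t)
    y-row {e} {t} e<L t≤r = ≡.cong (approx L) (≡.trans (≡.cong (dist j) (addMod-addMod j (s + e) t)) (dist-addMod j s+e+t<m))
      where
      s+e+t<m : s + e + t < m
      s+e+t<m = ℕₚ.≤-<-trans (ℕₚ.+-monoʳ-≤ (s + e) t≤r)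
                  (≡.subst (_< m) (≡.sym (s+e+r≡s+r+e e))
                    (ℕₚ.<-≤-trans (ℕₚ.+-monoʳ-< (s + r) e<L) (≡.subst (_≤ m) (≡.sym (ℕₚ.+-assoc s r L)) s+r+L≤m)))

    y-solves : ∀ e → e < L → ψ (row e) y ≈ target e
    y-solves e e<L = begin
        ψ (row e) y
      ≈⟨ ψ-row-expansion (row e) y ⟩
        sumℕ (suc r) (λ t → coeff e t · y (addMod (row e) t))
      ≈⟨ GSum.sumℕ-cong (suc r) (λ t t≤r → reflexive (≡.cong (coeff e t ·_) (y-row e<L (ℕ.s≤s⁻¹ t≤r)))) ⟩
        sumℕ (suc r) (λ t → coeff e t · approx L (s + e + t))
      ≈⟨ GSum.sumℕ-suc r (λ t → coeff e t · approx L (s + e + t)) ⟩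
        sumℕ r (λ t → coeff e t · approx L (s + e + t)) ∙ coeff e r · approx L (s + e + r)
      ≈⟨ ∙-cong (GSum.sumℕ-cong r (λ t t<r → reflexive (≡.cong (coeff e t ·_) (approx-final (ℕₚ.<⇒≤ e<L) (inRow t t<r)))))
                (reflexive (≡.cong (coeff e r ·_) lastCoordinate)) ⟩
        partial e ∙ coeff e r · (coeff e r · (target e ∙ partial e ⁻¹))
      ≈⟨ ∙-congˡ (unit-cancel (coeff e r) _ (Ψ-row-last-unit circular (row e))) ⟩
        partial e ∙ (target e ∙ partial e ⁻¹)
      ≈⟨ sym (assoc _ _ _) ⟩
        partial e ∙ target e ∙ partial e ⁻¹
      ≈⟨ xyx⁻¹≈y (partial e) (target e) ⟩
        target e
      ∎
      where
      inRow : ∀ t → t < r → s + e + t < s + r + e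
      inRow t t<r = ≡.subst (s + e + t <_) (s+e+r≡s+r+e e) (ℕₚ.+-monoʳ-< (s + e) t<r)
      lastCoordinate : approx L (s + e + r) ≡ next e
      lastCoordinate = ≡.trans
        (approx-final e<L (≡.subst (_< s + r + suc e) (≡.sym (s+e+r≡s+r+e e)) (ℕₚ.+-monoʳ-< (s + r) (ℕₚ.n<1+n e))))
        (≡.trans (≡.cong (approx (suc e)) (s+e+r≡s+r+e e)) (approx-next e))

  image⊆ker : ∀ y → InKer G M (act Ψ y)
  image⊆ker y a = trans (act-∘ M Ψ y a) (∑-zero (λ i → reflexive (≡.cong (_· y i) (M·Ψ≡0 a i))))

  ker⊆image : ∀ x → InKer G M x → Σ (Fin m → A) λ y → ∀ j → act Ψ y j ≈ x j
  ker⊆image x Mx≈ε = E.y , λ i →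
    x∙y⁻¹≈ε⇒x≈y _ _ (ker-vanishing-on-arc zero difference difference∈ker difference-on-arc i)
    where
    module E = Extension zero 0 (m ∸ r) (ℕₚ.≤-reflexive (ℕₚ.m+[n∸m]≡n (ℕₚ.<⇒≤ r<m)))
                         (λ _ → ε) (λ e → x (addMod zero e))
    difference : Fin m → A
    difference i = act Ψ E.y i ∙ x i ⁻¹
    difference∈ker : InKer G M difference
    difference∈ker a = trans (act-∙⁻¹ M (act Ψ E.y) x a) (trans (∙-cong (image⊆ker E.y a) (⁻¹-cong (Mx≈ε a))) (inverseʳ ε))
    difference-on-arc : ∀ t → t < m ∸ r → difference (addMod zero t) ≈ ε
    difference-on-arc t t<m∸r = x≈y⇒x∙y⁻¹≈ε (E.y-solves t t<m∸r)

  γ-∈ : ∀ {k} (e : Subset k) (z : Gpow G e) i (i∈e : i ∈ e) → γ G e z i ≈ z i i∈e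
  γ-∈ e z i i∈e with i ∈? e
  ... | yes i∈e′ = reflexive (≡.cong (z i) ([]=-irrelevant i∈e′ i∈e))
  ... | no  i∉e  = contradiction i∈e i∉e

  γ-∉ : ∀ {k} (e : Subset k) (z : Gpow G e) i → ¬ i ∈ e → γ G e z i ≈ ε
  γ-∉ e z i i∉e with i ∈? e
  ... | yes i∈e = contradiction i∈e i∉e
  ... | no  _   = refl

  proj⊆ker : ∀ j x → InKer G Ψ x → ψ j (γ G (Cset r j) (proj G (Cset r j) x)) ≈ ε
  proj⊆ker j x Ψx≈ε = trans (ψ-local j (γ-∈ (Cset r j) (proj G (Cset r j) x))) (Ψx≈ε j)

  -- Extend z beyond C_j so that rows j + 1, …, j + m - r - 1 vanish; with row j
  -- this is an arc of m - r zero coordinates of Ψ y ∈ ker M, so Ψ y = 0.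
  ker⊆proj : ∀ j (z : Gpow G (Cset r j)) → ψ j (γ G (Cset r j) z) ≈ ε →
             Σ (Fin m → A) λ y → InKer G Ψ y × (∀ i (i∈C : i ∈ Cset r j) → y i ≈ z i i∈C)
  ker⊆proj j z ψγz≈ε = E.y , Ψy≈ε , λ i i∈C → trans (agrees i i∈C) (γ-∈ (Cset r j) z i i∈C)
    where
    module E = Extension j 1 (n ∸ r) (s≤s (ℕₚ.≤-reflexive (ℕₚ.m+[n∸m]≡n (ℕₚ.<⇒≤ r<n)))) (γ G (Cset r j) z) (λ _ → ε)
    agrees : ∀ i → i ∈ Cset r j → E.y i ≈ γ G (Cset r j) z i
    agrees i i∈C = reflexive (E.y-agrees i (s≤s (∈Cset⇒dist≤ r j i i∈C)))
    arc : ∀ t → t < m ∸ r → ψ (addMod j t) E.y ≈ ε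
    arc zero    _         = trans (reflexive (≡.cong (λ k → ψ k E.y) (addMod-zero j))) (trans (ψ-local j agrees) ψγz≈ε)
    arc (suc e) e+1<m∸r = E.y-solves e (ℕ.s≤s⁻¹ (≡.subst (suc e <_) (ℕₚ.+-∸-assoc 1 (ℕₚ.<⇒≤ r<n)) e+1<m∸r))
    Ψy≈ε : InKer G Ψ E.y
    Ψy≈ε = ker-vanishing-on-arc j (act Ψ E.y) (image⊆ker E.y) arc

  supp⊆Cset : ∀ j i → InSupp G (ψ j) i → i ∈ Cset r j
  supp⊆Cset j i i∈supp with i ∈? Cset r j
  ... | yes i∈C = i∈C
  ... | no  i∉C = ⊥-elim (i∈supp λ z →
    trans (ψ-local j (outside-i z)) (∑-zero (λ i′ → ·-zeroʳ (Ψ j i′))))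
    where
    outside-i : ∀ z i′ → i′ ∈ Cset r j → γ G ⁅ i ⁆ z i′ ≈ ε
    outside-i z i′ i′∈C = γ-∉ ⁅ i ⁆ z i′ (λ i′∈⁅i⁆ → i∉C (≡.subst (_∈ Cset r j) (x∈⁅y⁆⇒x≡y i i′∈⁅i⁆) i′∈C))

  isRepresentation : IsRepresentation G (suc r) M Ψ (Cset r)
  isRepresentation = record
    { C-size     = Cset-size r r<m
    ; C-distinct = Cset-injective r (s≤s r<n)
    ; supp⊆C     = supp⊆Cset
    ; image⊆ker  = image⊆ker
    ; ker⊆image  = ker⊆image
    ; proj⊆ker   = proj⊆ker
    ; ker⊆proj   = ker⊆proj
    }

open import Data.Nat using (_+_)

lemma4p14 : (r m : ℕ) (M : Mat r m) → r + 2 ≤ m → Circular M →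
            Σω (Mat m m) (λ Ψ → ∀ {c ℓ} (G : AbelianGroup c ℓ) →
              IsRepresentation G (suc r) M Ψ (Cset r))
lemma4p14 zero    zero    M () _
lemma4p14 (suc r) zero    M () _
lemma4p14 r       (suc n) M r+2≤m circular =
  Construction.Ψ r M (ℕₚ.m<n⇒m<1+n r<n) , Representation.isRepresentation r M r<n circular
  where
  r<n : r < n
  r<n = ℕ.s≤s⁻¹ (≡.subst (_≤ suc n) (ℕₚ.+-comm r 2) r+2≤m)
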